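{- Let $r\ge2$, $n=2^r$. (1) All zeroed diamond codes of length $n+1$ have the same weight distribution, and all non-zeroed diamond codes of length $n+1$ have the same weight distribution. (2) All zeroed ENP1CCs of length $n+1$ have the same weight distribution. The non-zeroed ENP1CCs of length $n+1$ have exactly three possible weight distributions: one for which $A_0=0$, $A_1=1$, $A_2=0$; one for which $A_0=0$, $A_1=2$, $A_2=0$; and one for which $A_0=0$, $A_1=0$, $A_2=\frac{n}{2}+1$.
   Context: All codes are binary; for a code $\mathcal{C}$ of length $m$, its weight distribution is $(A_0,\dots,A_m)$ with $A_i$ the number of codewords of Hamming weight $i$. A code is zeroed if it contains the all-zero word and non-zeroed otherwise. An NP1CC of length $n=2^r$ is a code $\mathcal{C}\subseteq\mathbb{F}_2^n$ with $|\mathcal{C}|=2^{n-r}$ such that every word of $\mathbb{F}_2^n$ is at distance at most $1$ from some codeword. An ENP1CC is a code of length $n+1$ of the form $\{(\mathbf{c},p(\mathbf{c})):\mathbf{c}\in\mathcal{C}\}$ or $\{(\mathbf{c},1+p(\mathbf{c})):\mathbf{c}\in\mathcal{C}\}$ for an NP1CC $\mathcal{C}$, where $p(\mathbf{c})=\sum_i c_i\bmod 2$. A diamond code of length $m$ is a code $\hat{\mathcal{C}}\subseteq\mathbb{F}_2^m$, nonempty with nonempty complement, such that every codeword has exactly $2$ codewords at distance $1$ and every non-codeword has exactly $1$ codeword at distance $1$. -}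

module Defs where

open import Data.Nat using (ℕ; zero; suc; _+_; _∸_; _^_; _≤_; _≡ᵇ_)
open import Data.Bool using (Bool; true; false; _∧_; _xor_; not; if_then_else_)
open import Data.Vec using (Vec; []; _∷_; replicate; init; last; zipWith; foldr)
open import Data.List using (List; []; _∷_; _++_; map; length; filter)
open import Data.Product using (Σ; ∃; ∃-syntax; _×_; _,_)
open import Relation.Binary.PropositionalEquality using (_≡_)
open import Relation.Nullary using (¬_)
open import Relation.Nullary.Decidable using (Dec)
open import Data.Bool.Properties using (_≟_)

Word : ℕ → Set
Word m = Vec Bool m

Code : ℕ → Set
Code m = Word m → Bool

allWords : (m : ℕ) → List (Word m)
allWords zero = [] ∷ []
allWords (suc m) = map (false ∷_) (allWords m) ++ map (true ∷_) (allWords m)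

countW : {m : ℕ} → (Word m → Bool) → ℕ
countW {m} P = length (filter (λ w → P w ≟ true) (allWords m))

weight : {m : ℕ} → Word m → ℕ
weight = foldr _ (λ b k → (if b then 1 else 0) + k) 0

dist : {m : ℕ} → Word m → Word m → ℕ
dist u v = weight (zipWith _xor_ u v)

size : {m : ℕ} → Code m → ℕ
size C = countW C

A : {m : ℕ} → Code m → ℕ → ℕ
A C i = countW (λ w → C w ∧ (weight w ≡ᵇ i))

SameWD : {m : ℕ} → Code m → Code m → Set
SameWD C D = ∀ i → A C i ≡ A D i

Zeroed : {m : ℕ} → Code m → Set
Zeroed {m} C = C (replicate m false) ≡ true

nbrs : {m : ℕ} → Code m → Word m → ℕ
nbrs C w = countW (λ v → C v ∧ (dist w v ≡ᵇ 1))

Diamond : {m : ℕ} → Code m → Set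
Diamond C =
  (∃[ w ] C w ≡ true) ×
  (∃[ w ] C w ≡ false) ×
  (∀ w → C w ≡ true → nbrs C w ≡ 2) ×
  (∀ w → C w ≡ false → nbrs C w ≡ 1)

NP1CC : (r : ℕ) → Code (2 ^ r) → Set
NP1CC r C =
  size C ≡ 2 ^ (2 ^ r ∸ r) ×
  (∀ w → ∃[ c ] (C c ≡ true × dist w c ≤ 1))

parity : {m : ℕ} → Word m → Bool
parity = foldr _ _xor_ false

-- extension of a code C of length n by the bit p(c) xor b at the end
-- ext false C = {(c, p(c))},  ext true C = {(c, 1 + p(c))}
ext : {n : ℕ} → Bool → Code n → Code (suc n)
ext b C w = C (init w) ∧ (if last w xor (parity (init w) xor b) then false else true)

ENP1CC : (r : ℕ) → Code (suc (2 ^ r)) → Set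
ENP1CC r E = ∃[ C ] ∃[ b ] (NP1CC r C × (∀ w → E w ≡ ext b C w))

{-# OPTIONS --safe #-}
-- In a diamond code D of length M every word w has exactly 1 + [w ∈ D] codewords at distance 1.
-- Counting the pairs (w, v) with v ∈ D, dist w v = 1 and weight w = i gives
-- (M choose i) + A i = (i + 1) A (i + 1) + (M - i + 1) A (i - 1), so the weight distribution is
-- determined by A 0 = [0 ∈ D].
-- Let C be an NP1CC of length n = 2 ^ r and e w = |C ∩ B w| - 1 ≥ 0 its excess on the closed ball
-- of radius 1. Double counting with n |C| = 2 ^ n, a parity argument (n is even) and 3 ∤ n²
-- show that e ≤ 1 and that the sum of e over B w is 1 + [w ∈ C]. So C and T = {w | e w = 1} each
-- meet every ball B w in 1 + [w ∈ the other] words, and the code of length n + 1 that is C on the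
-- words of parity b and T on the others is a diamond code whose parity-b part is the ENP1CC of
-- (C, b). Hence the weight distribution of an ENP1CC depends only on b and on the bit d of this
-- diamond code at 0. Zeroed ENP1CCs have (b, d) = (0, 1); the three other pairs are realised by the
-- Hamming code of length n - 1 with a free coordinate added and by one of its cosets.
module Submission where

open import Defs
open import Data.Nat using (ℕ; suc; _+_; _^_; _≤_; _/_)
open import Data.Product using (Σ; ∃; ∃-syntax; _×_; _,_)
open import Data.Sum using (_⊎_)
open import Relation.Binary.PropositionalEquality using (_≡_)
open import Relation.Nullary using (¬_)

open import Data.Bool using (Bool; true; false; _∧_; _xor_; not; if_then_else_; T)
open import Data.Bool.Properties
  using (_≟_; ∧-zeroʳ; ∧-identityʳ; not-involutive; not-distribˡ-xor; not-distribʳ-xor;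
         xor-identityʳ; xor-assoc; xor-comm; xor-same; ¬-not)
open import Data.Fin using (Fin; zero; suc; finToFun; funToFin)
open import Data.Fin.Properties using (2↔Bool; finToFun-funToFin)
open import Data.List using (List; []; _∷_; _++_; map; length; filter)
open import Data.List.Properties using (map-++; map-∘)
open import Data.Nat using (zero; _*_; _∸_; _<_; _≡ᵇ_; z≤n; s≤s)
open import Data.Nat.DivMod using (m*n/n≡m)
open import Data.Nat.Divisibility using (_∣_; ∣⇒≤; divides)
open import Data.Nat.ListAction using (sum)
open import Data.Nat.ListAction.Properties using (sum-++)
open import Data.Nat.Primality using (prime?; euclidsLemma)
open import Data.Nat.Properties hiding (_≟_)
open import Data.Nat.Tactic.RingSolver using (solve-∀)
open import Data.Product using (proj₁; proj₂)
open import Data.Sum using (inj₁; inj₂)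
import Data.Sum as Sum
open import Data.Vec using ([]; _∷_; replicate; zipWith; init; last; _∷ʳ_; initLast; tabulate; lookup)
open import Data.Vec.Properties
  using (init-∷ʳ; last-∷ʳ; tabulate-cong; tabulate∘lookup; zipWith-assoc; zipWith-comm;
         zipWith-identityˡ; zipWith-identityʳ; zipWith-inverseʳ; map-id)
open import Function using (_∘_; id)
open import Function.Bundles using (Inverse)
open import Relation.Binary.PropositionalEquality using (_≢_; refl; sym; trans; cong; cong₂; subst; module ≡-Reasoning)
open import Relation.Nullary using (contradiction)
open import Relation.Nullary.Decidable using (from-yes)
open import Algebra.Properties.CommutativeSemigroup +-commutativeSemigroup using (interchange)
open ≡-Reasoning

⟦_⟧ : Bool → ℕ
⟦ true  ⟧ = 1
⟦ false ⟧ = 0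

⟦∧⟧ : ∀ a b → ⟦ a ∧ b ⟧ ≡ ⟦ a ⟧ * ⟦ b ⟧
⟦∧⟧ true  true  = refl
⟦∧⟧ true  false = refl
⟦∧⟧ false b     = refl

+-≤-≡⇒≡ : ∀ {a b c d} → a ≤ c → b ≤ d → a + b ≡ c + d → a ≡ c × b ≡ d
+-≤-≡⇒≡ {a} {b} {c} {d} a≤c b≤d eq = a≡c , +-cancelˡ-≡ c b d (trans (cong (_+ b) (sym a≡c)) eq)
  where
  a≡c : a ≡ c
  a≡c = ≤-antisym a≤c (+-cancelʳ-≤ b c a (≤-trans (+-monoʳ-≤ c b≤d) (≤-reflexive (sym eq))))

zeros : ∀ m → Word m
zeros m = replicate m false

-- Sums over all words and over Hamming spheres

sumW : ∀ {m} → (Word m → ℕ) → ℕ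
sumW {zero}  f = f []
sumW {suc m} f = sumW (λ x → f (false ∷ x)) + sumW (λ x → f (true ∷ x))

length-filter≡sum : ∀ {m} (P : Word m → Bool) xs →
  length (filter (λ w → P w ≟ true) xs) ≡ sum (map (λ w → ⟦ P w ⟧) xs)
length-filter≡sum P []       = refl
length-filter≡sum P (x ∷ xs) with P x
... | true  = cong suc (length-filter≡sum P xs)
... | false = length-filter≡sum P xs

sum-allWords : ∀ m (f : Word m → ℕ) → sum (map f (allWords m)) ≡ sumW f
sum-allWords zero    f = +-identityʳ (f [])
sum-allWords (suc m) f = begin
  sum (map f (map (false ∷_) ws ++ map (true ∷_) ws))
    ≡⟨ cong sum (map-++ f (map (false ∷_) ws) _) ⟩
  sum (map f (map (false ∷_) ws) ++ map f (map (true ∷_) ws))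
    ≡⟨ sum-++ (map f (map (false ∷_) ws)) _ ⟩
  sum (map f (map (false ∷_) ws)) + sum (map f (map (true ∷_) ws))
    ≡⟨ cong₂ _+_ (cong sum (sym (map-∘ ws))) (cong sum (sym (map-∘ ws))) ⟩
  sum (map (λ x → f (false ∷ x)) ws) + sum (map (λ x → f (true ∷ x)) ws)
    ≡⟨ cong₂ _+_ (sum-allWords m _) (sum-allWords m _) ⟩
  sumW f ∎
  where
  ws : List (Word m)
  ws = allWords m

countW≡sumW : ∀ {m} (P : Word m → Bool) → countW P ≡ sumW (λ w → ⟦ P w ⟧)
countW≡sumW {m} P = trans (length-filter≡sum P (allWords m)) (sum-allWords m _)

sumW-cong : ∀ {m} {f g : Word m → ℕ} → (∀ x → f x ≡ g x) → sumW f ≡ sumW g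
sumW-cong {zero}  f≡g = f≡g []
sumW-cong {suc m} f≡g = cong₂ _+_ (sumW-cong (λ x → f≡g (false ∷ x))) (sumW-cong (λ x → f≡g (true ∷ x)))

sumW-+ : ∀ {m} (f g : Word m → ℕ) → sumW (λ x → f x + g x) ≡ sumW f + sumW g
sumW-+ {zero}  f g = refl
sumW-+ {suc m} f g =
  trans (cong₂ _+_ (sumW-+ {m} _ _) (sumW-+ {m} _ _)) (interchange (sumW {m} (λ x → f (false ∷ x))) _ _ _)

sumW-* : ∀ {m} k (f : Word m → ℕ) → sumW (λ x → k * f x) ≡ k * sumW f
sumW-* {zero}  k f = refl
sumW-* {suc m} k f = trans (cong₂ _+_ (sumW-* {m} k _) (sumW-* {m} k _)) (sym (*-distribˡ-+ k _ _))

sumW-const : ∀ {m} k → sumW {m} (λ _ → k) ≡ 2 ^ m * k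
sumW-const {zero}  k = sym (+-identityʳ k)
sumW-const {suc m} k = begin
  sumW {m} (λ _ → k) + sumW {m} (λ _ → k) ≡⟨ cong₂ _+_ (sumW-const {m} k) (sumW-const {m} k) ⟩
  2 ^ m * k + 2 ^ m * k                   ≡⟨ sym (*-distribʳ-+ k (2 ^ m) _) ⟩
  (2 ^ m + 2 ^ m) * k                     ≡⟨ cong (λ z → (2 ^ m + z) * k) (sym (+-identityʳ (2 ^ m))) ⟩
  2 ^ suc m * k                           ∎

sumW≡0 : ∀ {m} {f : Word m → ℕ} → (∀ x → f x ≡ 0) → sumW f ≡ 0
sumW≡0 {m} f≡0 = trans (sumW-cong f≡0) (trans (sumW-const {m} 0) (*-zeroʳ (2 ^ m)))

sumW-mono : ∀ {m} {f g : Word m → ℕ} → (∀ x → f x ≤ g x) → sumW f ≤ sumW g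
sumW-mono {zero}  f≤g = f≤g []
sumW-mono {suc m} f≤g = +-mono-≤ (sumW-mono (λ x → f≤g (false ∷ x))) (sumW-mono (λ x → f≤g (true ∷ x)))

sumW-mono-≡⇒≡ : ∀ {m} {f g : Word m → ℕ} → (∀ x → f x ≤ g x) → sumW f ≡ sumW g → ∀ x → f x ≡ g x
sumW-mono-≡⇒≡ {zero}  f≤g eq []      = eq
sumW-mono-≡⇒≡ {suc m} {f} {g} f≤g eq (a ∷ x) = on a x
  where
  halves : sumW (λ y → f (false ∷ y)) ≡ sumW (λ y → g (false ∷ y)) ×
           sumW (λ y → f (true ∷ y)) ≡ sumW (λ y → g (true ∷ y))
  halves = +-≤-≡⇒≡ (sumW-mono (λ y → f≤g (false ∷ y))) (sumW-mono (λ y → f≤g (true ∷ y))) eq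
  on : ∀ a x → f (a ∷ x) ≡ g (a ∷ x)
  on false = sumW-mono-≡⇒≡ (λ y → f≤g (false ∷ y)) (proj₁ halves)
  on true  = sumW-mono-≡⇒≡ (λ y → f≤g (true ∷ y)) (proj₂ halves)

sumW-swap : ∀ {m k} (g : Word m → Word k → ℕ) →
  sumW (λ x → sumW (g x)) ≡ sumW (λ y → sumW (λ x → g x y))
sumW-swap {zero}      g = refl
sumW-swap {suc m} {k} g = begin
  sumW (λ x → sumW (g (false ∷ x))) + sumW (λ x → sumW (g (true ∷ x)))
    ≡⟨ cong₂ _+_ (sumW-swap (λ x → g (false ∷ x))) (sumW-swap (λ x → g (true ∷ x))) ⟩
  sumW (λ y → sumW (λ x → g (false ∷ x) y)) + sumW (λ y → sumW (λ x → g (true ∷ x) y))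
    ≡⟨ sym (sumW-+ (λ y → sumW (λ x → g (false ∷ x) y)) _) ⟩
  sumW (λ y → sumW (λ x → g x y)) ∎

flip : ∀ {m} → Fin m → Word m → Word m
flip zero    (a ∷ x) = not a ∷ x
flip (suc j) (a ∷ x) = a ∷ flip j x

sumW-flip : ∀ {m} (j : Fin m) (g : Word m → ℕ) → sumW (λ x → g (flip j x)) ≡ sumW g
sumW-flip zero    g = +-comm (sumW (λ x → g (true ∷ x))) _
sumW-flip (suc j) g = cong₂ _+_ (sumW-flip j (λ x → g (false ∷ x))) (sumW-flip j (λ x → g (true ∷ x)))

sumNbrs : ∀ {m} → Word m → (Word m → ℕ) → ℕ
sumNbrs []      g = 0
sumNbrs (a ∷ x) g = g (not a ∷ x) + sumNbrs x (λ y → g (a ∷ y))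

sumDist2 : ∀ {m} → Word m → (Word m → ℕ) → ℕ
sumDist2 []      g = 0
sumDist2 (a ∷ x) g = sumNbrs x (λ y → g (not a ∷ y)) + sumDist2 x (λ y → g (a ∷ y))

sumDist3 : ∀ {m} → Word m → (Word m → ℕ) → ℕ
sumDist3 []      g = 0
sumDist3 (a ∷ x) g = sumDist2 x (λ y → g (not a ∷ y)) + sumDist3 x (λ y → g (a ∷ y))

ballSum : ∀ {m} → Word m → (Word m → ℕ) → ℕ
ballSum x g = g x + sumNbrs x g

sumNbrs-cong : ∀ {m} (x : Word m) {g h : Word m → ℕ} →
  (∀ j → g (flip j x) ≡ h (flip j x)) → sumNbrs x g ≡ sumNbrs x h
sumNbrs-cong []      eq = refl
sumNbrs-cong (a ∷ x) eq = cong₂ _+_ (eq zero) (sumNbrs-cong x (λ j → eq (suc j)))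

sumNbrs-+ : ∀ {m} (x : Word m) (g h : Word m → ℕ) →
  sumNbrs x (λ y → g y + h y) ≡ sumNbrs x g + sumNbrs x h
sumNbrs-+ []      g h = refl
sumNbrs-+ (a ∷ x) g h = trans (cong (g (not a ∷ x) + h (not a ∷ x) +_) (sumNbrs-+ x _ _))
                              (interchange (g (not a ∷ x)) _ _ _)

sumNbrs-* : ∀ {m} (x : Word m) k (g : Word m → ℕ) → sumNbrs x (λ y → k * g y) ≡ k * sumNbrs x g
sumNbrs-* []      k g = sym (*-zeroʳ k)
sumNbrs-* (a ∷ x) k g = trans (cong (k * g (not a ∷ x) +_) (sumNbrs-* x k _)) (sym (*-distribˡ-+ k _ _))

sumNbrs-const : ∀ {m} (x : Word m) k → sumNbrs x (λ _ → k) ≡ m * k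
sumNbrs-const []      k = refl
sumNbrs-const (a ∷ x) k = cong (k +_) (sumNbrs-const x k)

flip≤sumNbrs : ∀ {m} (x : Word m) (g : Word m → ℕ) j → g (flip j x) ≤ sumNbrs x g
flip≤sumNbrs (a ∷ x) g zero    = m≤m+n _ _
flip≤sumNbrs (a ∷ x) g (suc j) = ≤-trans (flip≤sumNbrs x _ j) (m≤n+m _ _)

sumNbrs-sumW : ∀ {m k} (x : Word m) (g : Word m → Word k → ℕ) →
  sumNbrs x (λ y → sumW (g y)) ≡ sumW (λ s → sumNbrs x (λ y → g y s))
sumNbrs-sumW {k = k} []      g = sym (trans (sumW-const {k} 0) (*-zeroʳ (2 ^ k)))
sumNbrs-sumW         (a ∷ x) g = begin
  sumW (g (not a ∷ x)) + sumNbrs x (λ y → sumW (g (a ∷ y)))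
    ≡⟨ cong (sumW (g (not a ∷ x)) +_) (sumNbrs-sumW x (λ y → g (a ∷ y))) ⟩
  sumW (g (not a ∷ x)) + sumW (λ s → sumNbrs x (λ y → g (a ∷ y) s))
    ≡⟨ sym (sumW-+ (g (not a ∷ x)) _) ⟩
  sumW (λ s → sumNbrs (a ∷ x) (λ y → g y s)) ∎

sumNbrs² : ∀ {m} (x : Word m) (g : Word m → ℕ) →
  sumNbrs x (λ y → sumNbrs y g) ≡ m * g x + 2 * sumDist2 x g
sumNbrs² []              g = refl
sumNbrs² {suc m} (a ∷ x) g = begin
  (g (not (not a) ∷ x) + sumNbrs x gN) + sumNbrs x (λ y → gN y + sumNbrs y gA)
    ≡⟨ cong₂ _+_ (cong (λ b → g (b ∷ x) + sumNbrs x gN) (not-involutive a)) (sumNbrs-+ x gN _) ⟩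
  (g (a ∷ x) + sumNbrs x gN) + (sumNbrs x gN + sumNbrs x (λ y → sumNbrs y gA))
    ≡⟨ cong (λ z → (g (a ∷ x) + sumNbrs x gN) + (sumNbrs x gN + z)) (sumNbrs² x gA) ⟩
  (g (a ∷ x) + sumNbrs x gN) + (sumNbrs x gN + (m * g (a ∷ x) + 2 * sumDist2 x gA))
    ≡⟨ arith m (g (a ∷ x)) (sumNbrs x gN) (sumDist2 x gA) ⟩
  suc m * g (a ∷ x) + 2 * (sumNbrs x gN + sumDist2 x gA) ∎
  where
  gN gA : Word m → ℕ
  gN y = g (not a ∷ y)
  gA y = g (a ∷ y)
  arith : ∀ m p q r → (p + q) + (q + (m * p + 2 * r)) ≡ suc m * p + 2 * (q + r)
  arith = solve-∀

-- A word at distance 1 from x is at distance 2 from m - 1 neighbours of x, a word at distance 3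
-- from three of them; adding sumNbrs x g on the left avoids truncated subtraction.
sumNbrs-sumDist2 : ∀ {m} (x : Word m) (g : Word m → ℕ) →
  sumNbrs x (λ y → sumDist2 y g) + sumNbrs x g ≡ m * sumNbrs x g + 3 * sumDist3 x g
sumNbrs-sumDist2 []              g = refl
sumNbrs-sumDist2 {suc m} (a ∷ x) g = begin
  ((sumNbrs x (λ y → g (not (not a) ∷ y)) + D₂ gN) + sumNbrs x (λ y → sumNbrs y gN + sumDist2 y gA))
    + (gN x + sumNbrs x gA)
    ≡⟨ cong (λ z → ((z + D₂ gN) + sumNbrs x (λ y → sumNbrs y gN + sumDist2 y gA)) + (gN x + sumNbrs x gA))
            (sumNbrs-cong x (λ j → cong (λ b → g (b ∷ flip j x)) (not-involutive a))) ⟩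
  ((sumNbrs x gA + D₂ gN) + sumNbrs x (λ y → sumNbrs y gN + sumDist2 y gA)) + (gN x + sumNbrs x gA)
    ≡⟨ cong (λ z → ((sumNbrs x gA + D₂ gN) + z) + (gN x + sumNbrs x gA))
            (sumNbrs-+ x (λ y → sumNbrs y gN) (λ y → sumDist2 y gA)) ⟩
  ((sumNbrs x gA + D₂ gN) + (sumNbrs x (λ y → sumNbrs y gN) + sumNbrs x (λ y → sumDist2 y gA)))
    + (gN x + sumNbrs x gA)
    ≡⟨ cong (λ z → ((sumNbrs x gA + D₂ gN) + (z + sumNbrs x (λ y → sumDist2 y gA))) + (gN x + sumNbrs x gA))
            (sumNbrs² x gN) ⟩
  ((sumNbrs x gA + D₂ gN) + ((m * gN x + 2 * D₂ gN) + sumNbrs x (λ y → sumDist2 y gA)))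
    + (gN x + sumNbrs x gA)
    ≡⟨ shuffle m (sumNbrs x gA) (D₂ gN) (gN x) (sumNbrs x (λ y → sumDist2 y gA)) ⟩
  ((sumNbrs x gA + D₂ gN) + (m * gN x + 2 * D₂ gN)) + gN x
    + (sumNbrs x (λ y → sumDist2 y gA) + sumNbrs x gA)
    ≡⟨ cong (((sumNbrs x gA + D₂ gN) + (m * gN x + 2 * D₂ gN)) + gN x +_) (sumNbrs-sumDist2 x gA) ⟩
  ((sumNbrs x gA + D₂ gN) + (m * gN x + 2 * D₂ gN)) + gN x + (m * sumNbrs x gA + 3 * sumDist3 x gA)
    ≡⟨ collect m (sumNbrs x gA) (D₂ gN) (gN x) (sumDist3 x gA) ⟩
  suc m * (gN x + sumNbrs x gA) + 3 * (D₂ gN + sumDist3 x gA) ∎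
  where
  gN gA : Word m → ℕ
  gN y = g (not a ∷ y)
  gA y = g (a ∷ y)
  D₂ : (Word m → ℕ) → ℕ
  D₂ = sumDist2 x
  shuffle : ∀ m p q t s → ((p + q) + ((m * t + 2 * q) + s)) + (t + p) ≡ ((p + q) + (m * t + 2 * q)) + t + (s + p)
  shuffle = solve-∀
  collect : ∀ m p q t u → ((p + q) + (m * t + 2 * q)) + t + (m * p + 3 * u) ≡ suc m * (t + p) + 3 * (q + u)
  collect = solve-∀

sumW-sumNbrs : ∀ {m} (g : Word m → ℕ) → sumW (λ x → sumNbrs x g) ≡ m * sumW g
sumW-sumNbrs {zero}  g = refl
sumW-sumNbrs {suc m} g = begin
  sumW (λ x → gT x + sumNbrs x gF) + sumW (λ x → gF x + sumNbrs x gT)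
    ≡⟨ cong₂ _+_ (sumW-+ gT (λ x → sumNbrs x gF)) (sumW-+ gF (λ x → sumNbrs x gT)) ⟩
  (sumW gT + sumW (λ x → sumNbrs x gF)) + (sumW gF + sumW (λ x → sumNbrs x gT))
    ≡⟨ cong₂ (λ u v → (sumW gT + u) + (sumW gF + v)) (sumW-sumNbrs gF) (sumW-sumNbrs gT) ⟩
  (sumW gT + m * sumW gF) + (sumW gF + m * sumW gT)
    ≡⟨ arith m (sumW gT) (sumW gF) ⟩
  suc m * (sumW gF + sumW gT) ∎
  where
  gF gT : Word m → ℕ
  gF y = g (false ∷ y)
  gT y = g (true ∷ y)
  arith : ∀ m p q → (p + m * q) + (q + m * p) ≡ suc m * (q + p)
  arith = solve-∀

sumW-*-+ : ∀ {m} (f g h : Word m → ℕ) →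
  sumW (λ x → f x * (g x + h x)) ≡ sumW (λ x → f x * g x) + sumW (λ x → f x * h x)
sumW-*-+ f g h = trans (sumW-cong (λ x → *-distribˡ-+ (f x) (g x) (h x))) (sumW-+ (λ x → f x * g x) _)

sumNbrs-symmetric : ∀ {m} (f g : Word m → ℕ) →
  sumW (λ x → f x * sumNbrs x g) ≡ sumW (λ x → g x * sumNbrs x f)
sumNbrs-symmetric {zero}  f g = trans (*-zeroʳ (f [])) (sym (*-zeroʳ (g [])))
sumNbrs-symmetric {suc m} f g = begin
  sumW (λ x → fF x * (gT x + sumNbrs x gF)) + sumW (λ x → fT x * (gF x + sumNbrs x gT))
    ≡⟨ cong₂ _+_ (sumW-*-+ fF gT (λ x → sumNbrs x gF)) (sumW-*-+ fT gF (λ x → sumNbrs x gT)) ⟩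
  (sumW (λ x → fF x * gT x) + sumW (λ x → fF x * sumNbrs x gF))
    + (sumW (λ x → fT x * gF x) + sumW (λ x → fT x * sumNbrs x gT))
    ≡⟨ cong₂ (λ u v → (sumW (λ x → fF x * gT x) + u) + (sumW (λ x → fT x * gF x) + v))
             (sumNbrs-symmetric fF gF) (sumNbrs-symmetric fT gT) ⟩
  (sumW (λ x → fF x * gT x) + sumW (λ x → gF x * sumNbrs x fF))
    + (sumW (λ x → fT x * gF x) + sumW (λ x → gT x * sumNbrs x fT))
    ≡⟨ cong₂ (λ u v → (u + sumW (λ x → gF x * sumNbrs x fF)) + (v + sumW (λ x → gT x * sumNbrs x fT)))
             (sumW-cong (λ x → *-comm (fF x) (gT x))) (sumW-cong (λ x → *-comm (fT x) (gF x))) ⟩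
  (sumW (λ x → gT x * fF x) + sumW (λ x → gF x * sumNbrs x fF))
    + (sumW (λ x → gF x * fT x) + sumW (λ x → gT x * sumNbrs x fT))
    ≡⟨ arith (sumW (λ x → gT x * fF x)) _ (sumW (λ x → gF x * fT x)) (sumW (λ x → gT x * sumNbrs x fT)) ⟩
  (sumW (λ x → gF x * fT x) + sumW (λ x → gF x * sumNbrs x fF))
    + (sumW (λ x → gT x * fF x) + sumW (λ x → gT x * sumNbrs x fT))
    ≡⟨ sym (cong₂ _+_ (sumW-*-+ gF fT (λ x → sumNbrs x fF)) (sumW-*-+ gT fF (λ x → sumNbrs x fT))) ⟩
  sumW (λ x → gF x * (fT x + sumNbrs x fF)) + sumW (λ x → gT x * (fF x + sumNbrs x fT)) ∎
  where
  fF fT gF gT : Word m → ℕ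
  fF y = f (false ∷ y)
  fT y = f (true ∷ y)
  gF y = g (false ∷ y)
  gT y = g (true ∷ y)
  arith : ∀ p q r s → (p + q) + (r + s) ≡ (r + q) + (p + s)
  arith = solve-∀

sumW-ballSum : ∀ {m} (g : Word m → ℕ) → sumW (λ x → ballSum x g) ≡ suc m * sumW g
sumW-ballSum g = trans (sumW-+ g (λ x → sumNbrs x g)) (cong (sumW g +_) (sumW-sumNbrs g))

ballSum-symmetric : ∀ {m} (f g : Word m → ℕ) →
  sumW (λ x → f x * ballSum x g) ≡ sumW (λ x → g x * ballSum x f)
ballSum-symmetric f g = begin
  sumW (λ x → f x * ballSum x g)                        ≡⟨ sumW-*-+ f g (λ x → sumNbrs x g) ⟩
  sumW (λ x → f x * g x) + sumW (λ x → f x * sumNbrs x g) ≡⟨ cong₂ _+_ (sumW-cong (λ x → *-comm (f x) (g x)))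
                                                                      (sumNbrs-symmetric f g) ⟩
  sumW (λ x → g x * f x) + sumW (λ x → g x * sumNbrs x f) ≡⟨ sumW-*-+ g f (λ x → sumNbrs x f) ⟨
  sumW (λ x → g x * ballSum x f)                        ∎

_==_ : ∀ {m} → Word m → Word m → Bool
u == v = dist u v ≡ᵇ 0

==⇒≡ : ∀ {m} (u v : Word m) → T (u == v) → u ≡ v
==⇒≡ []          []          _  = refl
==⇒≡ (false ∷ u) (false ∷ v) eq = cong (false ∷_) (==⇒≡ u v eq)
==⇒≡ (true ∷ u)  (true ∷ v)  eq = cong (true ∷_) (==⇒≡ u v eq)

dist≤0⇒≡ : ∀ {m} (w c : Word m) → dist w c ≤ 0 → c ≡ w
dist≤0⇒≡ w c d≤0 = sym (==⇒≡ w c (≡⇒≡ᵇ _ 0 (n≤0⇒n≡0 d≤0)))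

dist-self : ∀ {m} (u : Word m) → dist u u ≡ 0
dist-self []          = refl
dist-self (false ∷ u) = dist-self u
dist-self (true ∷ u)  = dist-self u

==-refl : ∀ {m} (u : Word m) → u == u ≡ true
==-refl u = cong (_≡ᵇ 0) (dist-self u)

dist-flip : ∀ {m} (j : Fin m) (x : Word m) → dist x (flip j x) ≡ 1
dist-flip zero    (false ∷ x) = cong suc (dist-self x)
dist-flip zero    (true ∷ x)  = cong suc (dist-self x)
dist-flip (suc j) (false ∷ x) = dist-flip j x
dist-flip (suc j) (true ∷ x)  = dist-flip j x

≡⊎flip-∷ : ∀ {m} {w c : Word m} a →
  c ≡ w ⊎ ∃[ j ] c ≡ flip j w → a ∷ c ≡ a ∷ w ⊎ ∃[ j ] a ∷ c ≡ flip j (a ∷ w)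
≡⊎flip-∷ a = Sum.map (cong (a ∷_)) (λ (j , eq) → suc j , cong (a ∷_) eq)

dist≤1⇒ : ∀ {m} (w c : Word m) → dist w c ≤ 1 → c ≡ w ⊎ ∃[ j ] c ≡ flip j w
dist≤1⇒ []          []          _         = inj₁ refl
dist≤1⇒ (false ∷ w) (true ∷ c)  (s≤s d≤0) = inj₂ (zero , cong (true ∷_) (dist≤0⇒≡ w c d≤0))
dist≤1⇒ (true ∷ w)  (false ∷ c) (s≤s d≤0) = inj₂ (zero , cong (false ∷_) (dist≤0⇒≡ w c d≤0))
dist≤1⇒ (false ∷ w) (false ∷ c) d≤1       = ≡⊎flip-∷ false (dist≤1⇒ w c d≤1)
dist≤1⇒ (true ∷ w)  (true ∷ c)  d≤1       = ≡⊎flip-∷ true (dist≤1⇒ w c d≤1)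

sumW-==-sift : ∀ {m} (P : Word m → Bool) (w : Word m) → sumW (λ v → ⟦ P v ∧ (w == v) ⟧) ≡ ⟦ P w ⟧
sumW-==-sift P []          = cong ⟦_⟧ (∧-identityʳ (P []))
sumW-==-sift P (false ∷ w) = trans (cong₂ _+_ (sumW-==-sift (λ v → P (false ∷ v)) w)
                                         (sumW≡0 (λ v → cong ⟦_⟧ (∧-zeroʳ (P (true ∷ v))))))
                              (+-identityʳ _)
sumW-==-sift P (true ∷ w)  = cong₂ _+_ (sumW≡0 (λ v → cong ⟦_⟧ (∧-zeroʳ (P (false ∷ v)))))
                                  (sumW-==-sift (λ v → P (true ∷ v)) w)

sumW-== : ∀ {m} (u : Word m) → sumW (λ v → ⟦ u == v ⟧) ≡ 1
sumW-== u = sumW-==-sift (λ _ → true) u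

sumW-dist≡1 : ∀ {m} (P : Word m → Bool) (w : Word m) →
  sumW (λ v → ⟦ P v ∧ (dist w v ≡ᵇ 1) ⟧) ≡ sumNbrs w (λ v → ⟦ P v ⟧)
sumW-dist≡1 P []          = cong ⟦_⟧ (∧-zeroʳ (P []))
sumW-dist≡1 P (false ∷ w) =
  trans (cong₂ _+_ (sumW-dist≡1 (λ v → P (false ∷ v)) w) (sumW-==-sift (λ v → P (true ∷ v)) w))
        (+-comm _ ⟦ P (true ∷ w) ⟧)
sumW-dist≡1 P (true ∷ w)  = cong₂ _+_ (sumW-==-sift (λ v → P (false ∷ v)) w) (sumW-dist≡1 (λ v → P (true ∷ v)) w)

nbrs≡sumNbrs : ∀ {m} (C : Code m) (w : Word m) → nbrs C w ≡ sumNbrs w (λ v → ⟦ C v ⟧)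
nbrs≡sumNbrs C w = trans (countW≡sumW (λ v → C v ∧ (dist w v ≡ᵇ 1))) (sumW-dist≡1 C w)

covering⇒ballSum-pos : ∀ {m} {C : Code m} → (∀ w → ∃[ c ] (C c ≡ true × dist w c ≤ 1)) →
  ∀ w → 1 ≤ ballSum w (λ v → ⟦ C v ⟧)
covering⇒ballSum-pos {C = C} cover w with cover w
... | c , Cc , d≤1 with dist≤1⇒ w c d≤1
...   | inj₁ refl       = subst (λ b → 1 ≤ ⟦ b ⟧ + sumNbrs w (λ v → ⟦ C v ⟧)) (sym Cc) (s≤s z≤n)
...   | inj₂ (j , refl) = ≤-trans (≤-reflexive (cong ⟦_⟧ (sym Cc)))
                                  (≤-trans (flip≤sumNbrs w (λ v → ⟦ C v ⟧) j) (m≤n+m _ _))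

dist-zeros : ∀ {m} (w : Word m) → dist (zeros m) w ≡ weight w
dist-zeros []          = refl
dist-zeros (false ∷ w) = dist-zeros w
dist-zeros (true ∷ w)  = cong suc (dist-zeros w)

-- Weight distributions and diamond codes

weight≤length : ∀ {m} (v : Word m) → weight v ≤ m
weight≤length []          = z≤n
weight≤length (false ∷ v) = m≤n⇒m≤1+n (weight≤length v)
weight≤length (true ∷ v)  = s≤s (weight≤length v)

⟦≡ᵇ⟧-subst : ∀ k j (f : ℕ → ℕ) → ⟦ k ≡ᵇ j ⟧ * f k ≡ ⟦ k ≡ᵇ j ⟧ * f j
⟦≡ᵇ⟧-subst k j f with k ≡ᵇ j in eq
... | true  = cong (λ i → 1 * f i) (≡ᵇ⇒≡ k j (subst T (sym eq) _))
... | false = refl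

sumNbrs-weight : ∀ {m} (v : Word m) i → sumNbrs v (λ y → ⟦ weight y ≡ᵇ i ⟧) ≡
  ⟦ weight v ≡ᵇ suc i ⟧ * weight v + ⟦ suc (weight v) ≡ᵇ i ⟧ * (m ∸ weight v)
sumNbrs-weight []                  i = sym (*-zeroʳ ⟦ 1 ≡ᵇ i ⟧)
sumNbrs-weight {suc m} (false ∷ v) i = begin
  ⟦ suc k ≡ᵇ i ⟧ + sumNbrs v (λ y → ⟦ weight y ≡ᵇ i ⟧)
    ≡⟨ cong (⟦ suc k ≡ᵇ i ⟧ +_) (sumNbrs-weight v i) ⟩
  ⟦ suc k ≡ᵇ i ⟧ + (⟦ k ≡ᵇ suc i ⟧ * k + ⟦ suc k ≡ᵇ i ⟧ * (m ∸ k))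
    ≡⟨ arith ⟦ suc k ≡ᵇ i ⟧ ⟦ k ≡ᵇ suc i ⟧ k (m ∸ k) ⟩
  ⟦ k ≡ᵇ suc i ⟧ * k + ⟦ suc k ≡ᵇ i ⟧ * suc (m ∸ k)
    ≡⟨ cong (λ z → ⟦ k ≡ᵇ suc i ⟧ * k + ⟦ suc k ≡ᵇ i ⟧ * z) (sym (+-∸-assoc 1 (weight≤length v))) ⟩
  ⟦ k ≡ᵇ suc i ⟧ * k + ⟦ suc k ≡ᵇ i ⟧ * (suc m ∸ k) ∎
  where
  k : ℕ
  k = weight v
  arith : ∀ x y k l → x + (y * k + x * l) ≡ y * k + x * suc l
  arith = solve-∀
sumNbrs-weight {suc m} (true ∷ v) zero = begin
  ⟦ k ≡ᵇ 0 ⟧ + sumNbrs v (λ _ → 0) ≡⟨ cong (⟦ k ≡ᵇ 0 ⟧ +_) (trans (sumNbrs-const v 0) (*-zeroʳ m)) ⟩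
  ⟦ k ≡ᵇ 0 ⟧ + 0                   ≡⟨ trans (+-identityʳ _) (sym (*-identityʳ _)) ⟩
  ⟦ k ≡ᵇ 0 ⟧ * 1                   ≡⟨ ⟦≡ᵇ⟧-subst k 0 suc ⟨
  ⟦ k ≡ᵇ 0 ⟧ * suc k               ≡⟨ +-identityʳ _ ⟨
  ⟦ k ≡ᵇ 0 ⟧ * suc k + 0           ∎
  where
  k : ℕ
  k = weight v
sumNbrs-weight {suc m} (true ∷ v) (suc i) = begin
  ⟦ k ≡ᵇ suc i ⟧ + sumNbrs v (λ y → ⟦ weight y ≡ᵇ i ⟧)
    ≡⟨ cong (⟦ k ≡ᵇ suc i ⟧ +_) (sumNbrs-weight v i) ⟩
  ⟦ k ≡ᵇ suc i ⟧ + (⟦ k ≡ᵇ suc i ⟧ * k + ⟦ suc k ≡ᵇ i ⟧ * (m ∸ k))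
    ≡⟨ arith ⟦ k ≡ᵇ suc i ⟧ k (⟦ suc k ≡ᵇ i ⟧ * (m ∸ k)) ⟩
  ⟦ k ≡ᵇ suc i ⟧ * suc k + ⟦ suc k ≡ᵇ i ⟧ * (m ∸ k) ∎
  where
  k : ℕ
  k = weight v
  arith : ∀ x k z → x + (x * k + z) ≡ x * suc k + z
  arith = solve-∀

A≡sumW : ∀ {m} (C : Code m) i → A C i ≡ sumW (λ w → ⟦ C w ⟧ * ⟦ weight w ≡ᵇ i ⟧)
A≡sumW C i = trans (countW≡sumW (λ w → C w ∧ (weight w ≡ᵇ i))) (sumW-cong (λ w → ⟦∧⟧ (C w) _))

A-cong : ∀ {m} {C D : Code m} → (∀ w → C w ≡ D w) → SameWD C D
A-cong {C = C} {D} C≡D i =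
  trans (A≡sumW C i)
        (trans (sumW-cong (λ w → cong (λ b → ⟦ b ⟧ * ⟦ weight w ≡ᵇ i ⟧) (C≡D w))) (sym (A≡sumW D i)))

A-zero : ∀ {m} (C : Code m) → A C 0 ≡ ⟦ C (zeros m) ⟧
A-zero C = trans (A≡sumW C 0) (sumW-weight0 C)
  where
  sumW-weight0 : ∀ {m} (C : Code m) → sumW (λ w → ⟦ C w ⟧ * ⟦ weight w ≡ᵇ 0 ⟧) ≡ ⟦ C (zeros m) ⟧
  sumW-weight0 {zero}  C = *-identityʳ _
  sumW-weight0 {suc m} C = trans (cong₂ _+_ (sumW-weight0 (λ w → C (false ∷ w)))
                                            (sumW≡0 (λ w → *-zeroʳ ⟦ C (true ∷ w) ⟧)))
                                 (+-identityʳ _)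

wordsOfWeight : ∀ m → ℕ → ℕ
wordsOfWeight m i = sumW {m} (λ w → ⟦ weight w ≡ᵇ i ⟧)

wordsOfWeight-dist : ∀ m i → wordsOfWeight m i ≡ sumW (λ w → ⟦ true ∧ (dist (zeros m) w ≡ᵇ i) ⟧)
wordsOfWeight-dist m i = sumW-cong {m} (λ w → cong (λ k → ⟦ k ≡ᵇ i ⟧) (sym (dist-zeros w)))

wordsOfWeight-0 : ∀ m → wordsOfWeight m 0 ≡ 1
wordsOfWeight-0 m = trans (wordsOfWeight-dist m 0) (sumW-==-sift (λ _ → true) (zeros m))

wordsOfWeight-1 : ∀ m → wordsOfWeight m 1 ≡ m
wordsOfWeight-1 m = trans (wordsOfWeight-dist m 1)
  (trans (sumW-dist≡1 (λ _ → true) (zeros m)) (trans (sumNbrs-const (zeros m) 1) (*-identityʳ m)))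

LocallyDiamond : ∀ {m} → Code m → Set
LocallyDiamond C = ∀ w → sumNbrs w (λ v → ⟦ C v ⟧) ≡ suc ⟦ C w ⟧

Diamond⇒LocallyDiamond : ∀ {m} {C : Code m} → Diamond C → LocallyDiamond C
Diamond⇒LocallyDiamond {C = C} (_ , _ , nbrs≡2 , nbrs≡1) w with C w in eq
... | true  = trans (sym (nbrs≡sumNbrs C w)) (nbrs≡2 w eq)
... | false = trans (sym (nbrs≡sumNbrs C w)) (nbrs≡1 w eq)

module _ {M} {D : Code M} (diamond : LocallyDiamond D) where

  private
    d : Word M → ℕ
    d w = ⟦ D w ⟧

  A-recurrence : ∀ i → wordsOfWeight M i + A D i ≡
    sumW (λ w → d w * (⟦ weight w ≡ᵇ suc i ⟧ * suc i + ⟦ suc (weight w) ≡ᵇ i ⟧ * (M ∸ weight w)))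
  A-recurrence i = begin
    wordsOfWeight M i + A D i
      ≡⟨ cong (wordsOfWeight M i +_) (A≡sumW D i) ⟩
    wordsOfWeight M i + sumW (λ w → d w * ⟦ weight w ≡ᵇ i ⟧)
      ≡⟨ sumW-+ {M} (λ w → ⟦ weight w ≡ᵇ i ⟧) _ ⟨
    sumW (λ w → ⟦ weight w ≡ᵇ i ⟧ + d w * ⟦ weight w ≡ᵇ i ⟧)
      ≡⟨ sumW-cong (λ w → trans (arith ⟦ weight w ≡ᵇ i ⟧ (d w))
                                (cong (⟦ weight w ≡ᵇ i ⟧ *_) (sym (diamond w)))) ⟩
    sumW (λ w → ⟦ weight w ≡ᵇ i ⟧ * sumNbrs w d)
      ≡⟨ sumNbrs-symmetric (λ w → ⟦ weight w ≡ᵇ i ⟧) d ⟩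
    sumW (λ w → d w * sumNbrs w (λ y → ⟦ weight y ≡ᵇ i ⟧))
      ≡⟨ sumW-cong (λ w → cong (d w *_) (trans (sumNbrs-weight w i)
           (cong (_+ ⟦ suc (weight w) ≡ᵇ i ⟧ * (M ∸ weight w)) (⟦≡ᵇ⟧-subst (weight w) (suc i) id)))) ⟩
    sumW (λ w → d w * (⟦ weight w ≡ᵇ suc i ⟧ * suc i + ⟦ suc (weight w) ≡ᵇ i ⟧ * (M ∸ weight w))) ∎
    where
    arith : ∀ x y → x + y * x ≡ x * suc y
    arith = solve-∀

  A-recurrence₀ : wordsOfWeight M 0 + A D 0 ≡ A D 1
  A-recurrence₀ = trans (A-recurrence 0) (trans (sumW-cong (λ w → arith (d w) ⟦ weight w ≡ᵇ 1 ⟧ (M ∸ weight w)))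
                                                (sym (A≡sumW D 1)))
    where
    arith : ∀ x y z → x * (y * 1 + 0 * z) ≡ x * y
    arith = solve-∀

  A-recurrenceˢ : ∀ i → wordsOfWeight M (suc i) + A D (suc i) ≡ (2 + i) * A D (2 + i) + (M ∸ i) * A D i
  A-recurrenceˢ i = begin
    wordsOfWeight M (suc i) + A D (suc i)
      ≡⟨ A-recurrence (suc i) ⟩
    sumW (λ w → d w * (⟦ weight w ≡ᵇ 2 + i ⟧ * (2 + i) + ⟦ weight w ≡ᵇ i ⟧ * (M ∸ weight w)))
      ≡⟨ sumW-cong (λ w → cong (λ z → d w * (⟦ weight w ≡ᵇ 2 + i ⟧ * (2 + i) + z))
                               (⟦≡ᵇ⟧-subst (weight w) i (M ∸_))) ⟩
    sumW (λ w → d w * (⟦ weight w ≡ᵇ 2 + i ⟧ * (2 + i) + ⟦ weight w ≡ᵇ i ⟧ * (M ∸ i)))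
      ≡⟨ sumW-cong (λ w → arith (d w) ⟦ weight w ≡ᵇ 2 + i ⟧ (2 + i) ⟦ weight w ≡ᵇ i ⟧ (M ∸ i)) ⟩
    sumW (λ w → (2 + i) * (d w * ⟦ weight w ≡ᵇ 2 + i ⟧) + (M ∸ i) * (d w * ⟦ weight w ≡ᵇ i ⟧))
      ≡⟨ sumW-+ {M} (λ w → (2 + i) * (d w * ⟦ weight w ≡ᵇ 2 + i ⟧)) _ ⟩
    sumW (λ w → (2 + i) * (d w * ⟦ weight w ≡ᵇ 2 + i ⟧)) + sumW (λ w → (M ∸ i) * (d w * ⟦ weight w ≡ᵇ i ⟧))
      ≡⟨ cong₂ _+_ (sumW-* {M} (2 + i) _) (sumW-* {M} (M ∸ i) _) ⟩
    (2 + i) * sumW (λ w → d w * ⟦ weight w ≡ᵇ 2 + i ⟧) + (M ∸ i) * sumW (λ w → d w * ⟦ weight w ≡ᵇ i ⟧)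
      ≡⟨ cong₂ (λ u v → (2 + i) * u + (M ∸ i) * v) (A≡sumW D (2 + i)) (A≡sumW D i) ⟨
    (2 + i) * A D (2 + i) + (M ∸ i) * A D i ∎
    where
    arith : ∀ x y k z l → x * (y * k + z * l) ≡ k * (x * y) + l * (x * z)
    arith = solve-∀


  locallyDiamond-A₁ : A D 1 ≡ suc ⟦ D (zeros M) ⟧
  locallyDiamond-A₁ = trans (sym A-recurrence₀) (cong₂ _+_ (wordsOfWeight-0 M) (A-zero D))

  locallyDiamond-A₂ : D (zeros M) ≡ false → 2 * A D 2 ≡ suc M
  locallyDiamond-A₂ D0≡false = +-cancelʳ-≡ (M * A D 0) _ _ (begin
    2 * A D 2 + M * A D 0             ≡⟨ A-recurrenceˢ 0 ⟨
    wordsOfWeight M 1 + A D 1         ≡⟨ cong₂ _+_ (wordsOfWeight-1 M)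
                                                   (trans locallyDiamond-A₁ (cong (suc ∘ ⟦_⟧) D0≡false)) ⟩
    M + 1                             ≡⟨ +-comm M 1 ⟩
    suc M                             ≡⟨ +-identityʳ (suc M) ⟨
    suc M + 0                         ≡⟨ cong (suc M +_) (*-zeroʳ M) ⟨
    suc M + M * 0                     ≡⟨ cong (λ b → suc M + M * ⟦ b ⟧) D0≡false ⟨
    suc M + M * ⟦ D (zeros M) ⟧       ≡⟨ cong (λ a → suc M + M * a) (A-zero D) ⟨
    suc M + M * A D 0                 ∎)

locallyDiamond-sameWD : ∀ {M} {C D : Code M} → LocallyDiamond C → LocallyDiamond D →
  C (zeros M) ≡ D (zeros M) → SameWD C D
locallyDiamond-sameWD {M} {C} {D} dC dD C0≡D0 i = proj₁ (consecutive i)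
  where
  consecutive : ∀ i → A C i ≡ A D i × A C (suc i) ≡ A D (suc i)
  consecutive zero =
    A₀ , trans (sym (A-recurrence₀ dC)) (trans (cong (wordsOfWeight M 0 +_) A₀) (A-recurrence₀ dD))
    where
    A₀ : A C 0 ≡ A D 0
    A₀ = trans (A-zero C) (trans (cong ⟦_⟧ C0≡D0) (sym (A-zero D)))
  consecutive (suc i) with consecutive i
  ... | Aᵢ , Aᵢ₊₁ = Aᵢ₊₁ , *-cancelˡ-≡ _ _ (2 + i) (+-cancelʳ-≡ _ _ _ (begin
    (2 + i) * A C (2 + i) + (M ∸ i) * A D i ≡⟨ cong (λ a → (2 + i) * A C (2 + i) + (M ∸ i) * a) Aᵢ ⟨
    (2 + i) * A C (2 + i) + (M ∸ i) * A C i ≡⟨ A-recurrenceˢ dC i ⟨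
    wordsOfWeight M (suc i) + A C (suc i)   ≡⟨ cong (wordsOfWeight M (suc i) +_) Aᵢ₊₁ ⟩
    wordsOfWeight M (suc i) + A D (suc i)   ≡⟨ A-recurrenceˢ dD i ⟩
    (2 + i) * A D (2 + i) + (M ∸ i) * A D i ∎))

diamond-sameWD : ∀ {M} {C D : Code M} → Diamond C → Diamond D → C (zeros M) ≡ D (zeros M) → SameWD C D
diamond-sameWD dC dD = locallyDiamond-sameWD (Diamond⇒LocallyDiamond dC) (Diamond⇒LocallyDiamond dD)

-- Gluing two codes along the parity

isOdd : ℕ → Bool
isOdd zero    = false
isOdd (suc k) = not (isOdd k)

parity-flip : ∀ {n} (j : Fin n) (x : Word n) → parity (flip j x) ≡ not (parity x)
parity-flip zero    (a ∷ x) = sym (not-distribˡ-xor a (parity x))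
parity-flip (suc j) (a ∷ x) = trans (cong (a xor_) (parity-flip j x)) (sym (not-distribʳ-xor a (parity x)))

parity-∷ʳ : ∀ {n} (x : Word n) t → parity (x ∷ʳ t) ≡ parity x xor t
parity-∷ʳ []      t = xor-identityʳ t
parity-∷ʳ (a ∷ x) t = trans (cong (a xor_) (parity-∷ʳ x t)) (sym (xor-assoc a (parity x) t))

parity≡isOdd-weight : ∀ {n} (w : Word n) → parity w ≡ isOdd (weight w)
parity≡isOdd-weight []          = refl
parity≡isOdd-weight (false ∷ w) = parity≡isOdd-weight w
parity≡isOdd-weight (true ∷ w)  = cong not (parity≡isOdd-weight w)

parity-zeros : ∀ n → parity (zeros n) ≡ false
parity-zeros zero    = refl
parity-zeros (suc n) = parity-zeros n

zeros-∷ʳ : ∀ n → zeros (suc n) ≡ zeros n ∷ʳ false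
zeros-∷ʳ zero    = refl
zeros-∷ʳ (suc n) = cong (false ∷_) (zeros-∷ʳ n)

∷ʳ-induction : ∀ {n} (Prop : Word (suc n) → Set) → (∀ x t → Prop (x ∷ʳ t)) → ∀ w → Prop w
∷ʳ-induction Prop prop w with initLast w
... | x , t , refl = prop x t

sumNbrs-∷ʳ : ∀ {n} (x : Word n) t (g : Word (suc n) → ℕ) →
  sumNbrs (x ∷ʳ t) g ≡ sumNbrs x (λ y → g (y ∷ʳ t)) + g (x ∷ʳ not t)
sumNbrs-∷ʳ []      t g = +-identityʳ _
sumNbrs-∷ʳ (a ∷ x) t g = trans (cong (g (not a ∷ (x ∷ʳ t)) +_) (sumNbrs-∷ʳ x t (λ y → g (a ∷ y))))
                               (sym (+-assoc (g (not a ∷ (x ∷ʳ t))) _ _))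

-- P on the words of parity b, Q on the others.
glue : ∀ {n} → Bool → Code n → Code n → Code (suc n)
glue b P Q w = if last w xor (parity (init w) xor b) then Q (init w) else P (init w)

glue-∷ʳ : ∀ {n} b (P Q : Code n) x t → glue b P Q (x ∷ʳ t) ≡ (if t xor (parity x xor b) then Q x else P x)
glue-∷ʳ b P Q x t rewrite init-∷ʳ t x | last-∷ʳ t x = refl

glue-zeros : ∀ {n} b (P Q : Code n) → glue b P Q (zeros (suc n)) ≡ (if b then Q (zeros n) else P (zeros n))
glue-zeros {n} b P Q = begin
  glue b P Q (zeros (suc n))
    ≡⟨ cong (glue b P Q) (zeros-∷ʳ n) ⟩
  glue b P Q (zeros n ∷ʳ false)
    ≡⟨ glue-∷ʳ b P Q (zeros n) false ⟩
  (if parity (zeros n) xor b then Q (zeros n) else P (zeros n))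
    ≡⟨ cong (λ p → if p xor b then Q (zeros n) else P (zeros n)) (parity-zeros n) ⟩
  (if b then Q (zeros n) else P (zeros n)) ∎

glue-locallyDiamond : ∀ {n} b {P Q : Code n} →
  (∀ x → ballSum x (λ v → ⟦ P v ⟧) ≡ suc ⟦ Q x ⟧) →
  (∀ x → ballSum x (λ v → ⟦ Q v ⟧) ≡ suc ⟦ P x ⟧) →
  LocallyDiamond (glue b P Q)
glue-locallyDiamond {n} b {P} {Q} ballP ballQ = ∷ʳ-induction _ at
  where
  select : Bool → Code n
  select u x = if u then Q x else P x

  ball : ∀ u x → ballSum x (λ v → ⟦ select (not u) v ⟧) ≡ suc ⟦ select u x ⟧
  ball false = ballQ
  ball true  = ballP

  at : ∀ x t → sumNbrs (x ∷ʳ t) (λ v → ⟦ glue b P Q v ⟧) ≡ suc ⟦ glue b P Q (x ∷ʳ t) ⟧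
  at x t = begin
    sumNbrs (x ∷ʳ t) (λ v → ⟦ glue b P Q v ⟧)
      ≡⟨ sumNbrs-∷ʳ x t _ ⟩
    sumNbrs x (λ y → ⟦ glue b P Q (y ∷ʳ t) ⟧) + ⟦ glue b P Q (x ∷ʳ not t) ⟧
      ≡⟨ cong₂ _+_ (sumNbrs-cong x (λ j → cong ⟦_⟧ (trans (glue-∷ʳ b P Q (flip j x) t)
                                                            (cong (λ v → select v (flip j x)) (nbr-parity j)))))
                   (cong ⟦_⟧ (trans (glue-∷ʳ b P Q x (not t)) (cong (λ v → select v x) (sym (not-distribˡ-xor t _))))) ⟩
    sumNbrs x (λ y → ⟦ select (not u) y ⟧) + ⟦ select (not u) x ⟧
      ≡⟨ +-comm _ ⟦ select (not u) x ⟧ ⟩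
    ballSum x (λ y → ⟦ select (not u) y ⟧)
      ≡⟨ ball u x ⟩
    suc ⟦ select u x ⟧
      ≡⟨ cong (suc ∘ ⟦_⟧) (glue-∷ʳ b P Q x t) ⟨
    suc ⟦ glue b P Q (x ∷ʳ t) ⟧ ∎
    where
    u : Bool
    u = t xor (parity x xor b)
    nbr-parity : ∀ j → t xor (parity (flip j x) xor b) ≡ not u
    nbr-parity j = begin
      t xor (parity (flip j x) xor b) ≡⟨ cong (λ p → t xor (p xor b)) (parity-flip j x) ⟩
      t xor (not (parity x) xor b)    ≡⟨ cong (t xor_) (not-distribˡ-xor (parity x) b) ⟨
      t xor not (parity x xor b)      ≡⟨ not-distribʳ-xor t _ ⟨
      not u                           ∎

ext≡parity∧glue : ∀ {n} b (P Q : Code n) w → ext b P w ≡ not (parity w xor b) ∧ glue b P Q w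
ext≡parity∧glue b P Q = ∷ʳ-induction _ at
  where
  ext-∷ʳ : ∀ x t → ext b P (x ∷ʳ t) ≡ P x ∧ (if t xor (parity x xor b) then false else true)
  ext-∷ʳ x t rewrite init-∷ʳ t x | last-∷ʳ t x = refl

  keep-if-not : ∀ u {a q} → a ∧ (if u then false else true) ≡ not u ∧ (if u then q else a)
  keep-if-not true  {a} = ∧-zeroʳ a
  keep-if-not false {a} = ∧-identityʳ a

  at : ∀ x t → ext b P (x ∷ʳ t) ≡ not (parity (x ∷ʳ t) xor b) ∧ glue b P Q (x ∷ʳ t)
  at x t = begin
    ext b P (x ∷ʳ t)                                   ≡⟨ ext-∷ʳ x t ⟩
    P x ∧ (if u then false else true)                  ≡⟨ keep-if-not u ⟩
    not u ∧ (if u then Q x else P x)                   ≡⟨ cong₂ (λ v g → not v ∧ g) parity-∷ʳ-xor (glue-∷ʳ b P Q x t) ⟨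
    not (parity (x ∷ʳ t) xor b) ∧ glue b P Q (x ∷ʳ t) ∎
    where
    u : Bool
    u = t xor (parity x xor b)
    parity-∷ʳ-xor : parity (x ∷ʳ t) xor b ≡ u
    parity-∷ʳ-xor = begin
      parity (x ∷ʳ t) xor b   ≡⟨ cong (_xor b) (trans (parity-∷ʳ x t) (xor-comm (parity x) t)) ⟩
      (t xor parity x) xor b  ≡⟨ xor-assoc t (parity x) b ⟩
      u                       ∎

ext-zeros : ∀ {n} b (P : Code n) → ext b P (zeros (suc n)) ≡ not b ∧ P (zeros n)
ext-zeros {n} b P = begin
  ext b P (zeros (suc n))
    ≡⟨ ext≡parity∧glue b P P (zeros (suc n)) ⟩
  not (parity (zeros (suc n)) xor b) ∧ glue b P P (zeros (suc n))
    ≡⟨ cong₂ (λ p g → not (p xor b) ∧ g) (parity-zeros (suc n)) (glue-zeros b P P) ⟩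
  not b ∧ (if b then P (zeros n) else P (zeros n))
    ≡⟨ cong (not b ∧_) (if-same b) ⟩
  not b ∧ P (zeros n) ∎
  where
  if-same : ∀ {a} b → (if b then a else a) ≡ a
  if-same true  = refl
  if-same false = refl

A-ext : ∀ {n} b (P Q : Code n) i → A (ext b P) i ≡ ⟦ not (isOdd i xor b) ⟧ * A (glue b P Q) i
A-ext {n} b P Q i = begin
  A (ext b P) i
    ≡⟨ A≡sumW (ext b P) i ⟩
  sumW (λ w → ⟦ ext b P w ⟧ * [wt≡i] w)
    ≡⟨ sumW-cong pointwise ⟩
  sumW (λ w → κ * (⟦ glue b P Q w ⟧ * [wt≡i] w))
    ≡⟨ sumW-* κ (λ w → ⟦ glue b P Q w ⟧ * [wt≡i] w) ⟩
  κ * sumW (λ w → ⟦ glue b P Q w ⟧ * [wt≡i] w)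
    ≡⟨ cong (κ *_) (A≡sumW (glue b P Q) i) ⟨
  κ * A (glue b P Q) i ∎
  where
  κ : ℕ
  κ = ⟦ not (isOdd i xor b) ⟧
  [wt≡i] : Word (suc n) → ℕ
  [wt≡i] w = ⟦ weight w ≡ᵇ i ⟧
  pointwise : ∀ w → ⟦ ext b P w ⟧ * [wt≡i] w ≡ κ * (⟦ glue b P Q w ⟧ * [wt≡i] w)
  pointwise w with weight w ≡ᵇ i in wt≡i
  ... | false = trans (*-zeroʳ ⟦ ext b P w ⟧) (sym (trans (cong (κ *_) (*-zeroʳ ⟦ glue b P Q w ⟧)) (*-zeroʳ κ)))
  ... | true  = begin
    ⟦ ext b P w ⟧ * 1                                 ≡⟨ cong (λ e → ⟦ e ⟧ * 1) (ext≡parity∧glue b P Q w) ⟩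
    ⟦ not (parity w xor b) ∧ glue b P Q w ⟧ * 1       ≡⟨ cong (_* 1) (⟦∧⟧ (not (parity w xor b)) _) ⟩
    ⟦ not (parity w xor b) ⟧ * ⟦ glue b P Q w ⟧ * 1   ≡⟨ *-assoc ⟦ not (parity w xor b) ⟧ _ 1 ⟩
    ⟦ not (parity w xor b) ⟧ * (⟦ glue b P Q w ⟧ * 1) ≡⟨ cong (λ p → ⟦ not (p xor b) ⟧ * (⟦ glue b P Q w ⟧ * 1))
                                                             parity≡isOdd-i ⟩
    κ * (⟦ glue b P Q w ⟧ * 1)                        ∎
    where
    parity≡isOdd-i : parity w ≡ isOdd i
    parity≡isOdd-i = trans (parity≡isOdd-weight w) (cong isOdd (≡ᵇ⇒≡ (weight w) i (subst T (sym wt≡i) _)))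

-- Nearly perfect covering codes

n<2^n : ∀ n → n < 2 ^ n
n<2^n zero    = s≤s z≤n
n<2^n (suc n) = subst (suc (suc n) ≤_) (cong (2 ^ n +_) (sym (+-identityʳ (2 ^ n))))
                      (+-mono-≤ (m^n>0 2 n) (n<2^n n))

2^r*2^[2^r∸r] : ∀ r → 2 ^ r * 2 ^ (2 ^ r ∸ r) ≡ 2 ^ 2 ^ r
2^r*2^[2^r∸r] r = trans (sym (^-distribˡ-+-* 2 r (2 ^ r ∸ r))) (cong (2 ^_) (m+[n∸m]≡n (<⇒≤ (n<2^n r))))

2^r≡2*2^[r∸1] : ∀ {r} → 1 ≤ r → 2 ^ r ≡ 2 * 2 ^ (r ∸ 1)
2^r≡2*2^[r∸1] {suc r} _ = refl

2*m≤m*[1+m] : ∀ m → 2 * m ≤ m * suc m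
2*m≤m*[1+m] zero    = z≤n
2*m≤m*[1+m] (suc m) = subst (_≤ suc m * suc (suc m)) (*-comm (suc m) 2) (*-monoʳ-≤ (suc m) (s≤s (s≤s z≤n)))

2*m≡m*[1+m]⇒m≤1 : ∀ m → 2 * m ≡ m * suc m → m ≤ 1
2*m≡m*[1+m]⇒m≤1 zero                _  = z≤n
2*m≡m*[1+m]⇒m≤1 (suc zero)          _  = s≤s z≤n
2*m≡m*[1+m]⇒m≤1 m@(suc (suc _)) eq =
  contradiction (trans (*-comm m 2) eq) (<⇒≢ (*-monoʳ-< m (s≤s (s≤s (s≤s z≤n)))))

3∤2^ : ∀ k → ¬ 3 ∣ 2 ^ k
3∤2^ zero    3∣1 with ∣⇒≤ 3∣1
... | s≤s ()
3∤2^ (suc k) 3∣2^k+1 with euclidsLemma 2 (2 ^ k) (from-yes (prime? 3)) 3∣2^k+1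
... | inj₁ 3∣2 with ∣⇒≤ 3∣2
...   | s≤s (s≤s ())
3∤2^ (suc k) _ | inj₂ 3∣2^k = 3∤2^ k 3∣2^k

6*≢2^r*2^r : ∀ r q → 6 * q ≢ 2 ^ r * 2 ^ r
6*≢2^r*2^r r q eq = 3∤2^ (r + r) (divides (2 * q) (begin
  2 ^ (r + r)   ≡⟨ ^-distribˡ-+-* 2 r r ⟩
  2 ^ r * 2 ^ r ≡⟨ eq ⟨
  6 * q         ≡⟨ arith q ⟩
  2 * q * 3     ∎))
  where
  arith : ∀ q → 6 * q ≡ 2 * q * 3
  arith = solve-∀

2*a≡2+2^r⇒a≡2^r/2+1 : ∀ {r} → 1 ≤ r → ∀ a → 2 * a ≡ 2 + 2 ^ r → a ≡ 2 ^ r / 2 + 1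
2*a≡2+2^r⇒a≡2^r/2+1 {suc r} _ a eq = *-cancelˡ-≡ a _ 2 (begin
  2 * a                     ≡⟨ eq ⟩
  2 + 2 * 2 ^ r             ≡⟨ arith (2 ^ r) ⟩
  2 * (2 ^ r + 1)           ≡⟨ cong (λ h → 2 * (h + 1)) (m*n/n≡m (2 ^ r) 2) ⟨
  2 * (2 ^ r * 2 / 2 + 1)   ≡⟨ cong (λ k → 2 * (k / 2 + 1)) (*-comm (2 ^ r) 2) ⟩
  2 * (2 ^ suc r / 2 + 1)   ∎)
  where
  arith : ∀ h → 2 + 2 * h ≡ 2 * (h + 1)
  arith = solve-∀

module NP1CCStructure {r} (r≥1 : 1 ≤ r) {C : Code (2 ^ r)} (np : NP1CC r C) where

  private
    n s : ℕ
    n = 2 ^ r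
    s = 2 ^ (n ∸ r)

    c c̄ : Word n → ℕ
    c w = ⟦ C w ⟧
    c̄ w = ⟦ not (C w) ⟧

    c+c̄ : ∀ w → c w + c̄ w ≡ 1
    c+c̄ w with C w
    ... | true  = refl
    ... | false = refl

    sumW-c : sumW c ≡ s
    sumW-c = trans (sym (countW≡sumW C)) (proj₁ np)

    s+sumW-c̄ : s + sumW c̄ ≡ 2 ^ n
    s+sumW-c̄ = begin
      s + sumW c̄           ≡⟨ cong (_+ sumW c̄) sumW-c ⟨
      sumW c + sumW c̄      ≡⟨ sumW-+ c c̄ ⟨
      sumW (λ w → c w + c̄ w) ≡⟨ sumW-cong c+c̄ ⟩
      sumW {n} (λ _ → 1)   ≡⟨ trans (sumW-const {n} 1) (*-identityʳ _) ⟩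
      2 ^ n                ∎

  coverage : Word n → ℕ
  coverage w = ballSum w c

  excess : Word n → ℕ
  excess w = coverage w ∸ 1

  coverage≡suc-excess : ∀ w → coverage w ≡ suc (excess w)
  coverage≡suc-excess w = sym (trans (+-comm 1 (excess w)) (m∸n+n≡m (covering⇒ballSum-pos (proj₂ np) w)))

  near : Word n → ℕ
  near w = sumNbrs w c + sumDist2 w c

  ballSum-excess-parity : ∀ w → ballSum w excess + suc n ≡ suc n * c w + 2 * near w
  ballSum-excess-parity w = begin
    ballSum w excess + suc n
      ≡⟨ arith₁ (excess w) (sumNbrs w excess) n ⟩
    suc (excess w) + (n * 1 + sumNbrs w excess)
      ≡⟨ cong₂ _+_ (coverage≡suc-excess w) (cong (_+ sumNbrs w excess) (sumNbrs-const w 1)) ⟨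
    coverage w + (sumNbrs w (λ _ → 1) + sumNbrs w excess)
      ≡⟨ cong (coverage w +_) (sumNbrs-+ w (λ _ → 1) excess) ⟨
    coverage w + sumNbrs w (λ v → suc (excess v))
      ≡⟨ cong (coverage w +_) (sumNbrs-cong w (λ j → coverage≡suc-excess (flip j w))) ⟨
    coverage w + sumNbrs w coverage
      ≡⟨ cong (coverage w +_) (sumNbrs-+ w c (λ v → sumNbrs v c)) ⟩
    coverage w + (sumNbrs w c + sumNbrs w (λ v → sumNbrs v c))
      ≡⟨ cong (λ z → coverage w + (sumNbrs w c + z)) (sumNbrs² w c) ⟩
    (c w + sumNbrs w c) + (sumNbrs w c + (n * c w + 2 * sumDist2 w c))
      ≡⟨ arith₂ (c w) (sumNbrs w c) n (sumDist2 w c) ⟩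
    suc n * c w + 2 * near w ∎
    where
    arith₁ : ∀ e f n → (e + f) + suc n ≡ suc e + (n * 1 + f)
    arith₁ = solve-∀
    arith₂ : ∀ a b n q → (a + b) + (b + (n * a + 2 * q)) ≡ suc n * a + 2 * (b + q)
    arith₂ = solve-∀

  ballSum-excess-parity₀ : ∀ w → C w ≡ false → ballSum w excess + suc n ≡ 2 * near w
  ballSum-excess-parity₀ w Cw = trans (ballSum-excess-parity w)
    (trans (cong (λ b → suc n * ⟦ b ⟧ + 2 * near w) Cw) (cong (_+ 2 * near w) (*-zeroʳ (suc n))))

  ballSum-excess-parity₁ : ∀ w → C w ≡ true → ballSum w excess + suc n ≡ suc n + 2 * near w
  ballSum-excess-parity₁ w Cw = trans (ballSum-excess-parity w)
    (trans (cong (λ b → suc n * ⟦ b ⟧ + 2 * near w) Cw) (cong (_+ 2 * near w) (*-identityʳ (suc n))))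

  private
    n*s≡2^n : n * s ≡ 2 ^ n
    n*s≡2^n = 2^r*2^[2^r∸r] r

    sumW-ballSum-s : ∀ {g : Word n → ℕ} → sumW g ≡ s → sumW (λ w → ballSum w g) ≡ s + 2 ^ n
    sumW-ballSum-s {g} sumW-g = trans (sumW-ballSum {n} g) (trans (cong (suc n *_) sumW-g) (cong (s +_) n*s≡2^n))

  sumW-excess : sumW excess ≡ s
  sumW-excess = +-cancelˡ-≡ (2 ^ n) _ _ (begin
    2 ^ n + sumW excess               ≡⟨ cong (_+ sumW excess) (trans (sumW-const {n} 1) (*-identityʳ _)) ⟨
    sumW {n} (λ _ → 1) + sumW excess  ≡⟨ sumW-+ (λ _ → 1) excess ⟨
    sumW (λ w → suc (excess w))       ≡⟨ sumW-cong coverage≡suc-excess ⟨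
    sumW coverage                     ≡⟨ sumW-ballSum-s {c} sumW-c ⟩
    s + 2 ^ n                         ≡⟨ +-comm s _ ⟩
    2 ^ n + s                         ∎)

  ballSum-excess-noncodeword-pos : ∀ w → C w ≡ false → 1 ≤ ballSum w excess
  ballSum-excess-noncodeword-pos w Cw with ballSum w excess | ballSum-excess-parity₀ w Cw
  ... | suc _ | _      = s≤s z≤n
  ... | zero  | parity =
    contradiction (trans (sym parity) (cong suc (2^r≡2*2^[r∸1] r≥1))) (even≢odd (near w) (2 ^ (r ∸ 1)))

  -- 2 e ≤ e (e + 1), and a non-codeword has odd ballSum excess since n is even; both sides sum to
  -- s + 2 ^ n, so both bounds are attained.
  private
    lower upper : Word n → ℕ
    lower w = 2 * excess w + c̄ w
    upper w = excess w * coverage w + c̄ w * ballSum w excess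

    2*excess≤excess*coverage : ∀ w → 2 * excess w ≤ excess w * coverage w
    2*excess≤excess*coverage w =
      subst (λ k → 2 * excess w ≤ excess w * k) (sym (coverage≡suc-excess w)) (2*m≤m*[1+m] (excess w))

    c̄≤c̄*ballSum-excess : ∀ w → c̄ w ≤ c̄ w * ballSum w excess
    c̄≤c̄*ballSum-excess w = by-membership (C w) refl
      where
      by-membership : ∀ b → C w ≡ b → ⟦ not b ⟧ ≤ ⟦ not b ⟧ * ballSum w excess
      by-membership true  _  = z≤n
      by-membership false Cw = subst (1 ≤_) (sym (+-identityʳ _)) (ballSum-excess-noncodeword-pos w Cw)

    lower≤upper : ∀ w → lower w ≤ upper w
    lower≤upper w = +-mono-≤ (2*excess≤excess*coverage w) (c̄≤c̄*ballSum-excess w)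

    sumW-lower : sumW lower ≡ s + 2 ^ n
    sumW-lower = begin
      sumW lower                        ≡⟨ sumW-+ (λ w → 2 * excess w) c̄ ⟩
      sumW (λ w → 2 * excess w) + sumW c̄ ≡⟨ cong (_+ sumW c̄) (trans (sumW-* 2 excess) (cong (2 *_) sumW-excess)) ⟩
      2 * s + sumW c̄                    ≡⟨ cong (λ k → s + k + sumW c̄) (+-identityʳ s) ⟩
      s + s + sumW c̄                    ≡⟨ +-assoc s s (sumW c̄) ⟩
      s + (s + sumW c̄)                  ≡⟨ cong (s +_) s+sumW-c̄ ⟩
      s + 2 ^ n                         ∎

    sumW-upper : sumW upper ≡ s + 2 ^ n
    sumW-upper = begin
      sumW upper
        ≡⟨ sumW-+ (λ w → excess w * coverage w) (λ w → c̄ w * ballSum w excess) ⟩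
      sumW (λ w → excess w * ballSum w c) + sumW (λ w → c̄ w * ballSum w excess)
        ≡⟨ cong (_+ sumW (λ w → c̄ w * ballSum w excess)) (ballSum-symmetric excess c) ⟩
      sumW (λ w → c w * ballSum w excess) + sumW (λ w → c̄ w * ballSum w excess)
        ≡⟨ sumW-+ (λ w → c w * ballSum w excess) _ ⟨
      sumW (λ w → c w * ballSum w excess + c̄ w * ballSum w excess)
        ≡⟨ sumW-cong (λ w → trans (sym (*-distribʳ-+ (ballSum w excess) (c w) (c̄ w)))
                                  (trans (cong (_* ballSum w excess) (c+c̄ w)) (*-identityˡ _))) ⟩
      sumW (λ w → ballSum w excess)
        ≡⟨ sumW-ballSum-s sumW-excess ⟩
      s + 2 ^ n ∎

    lower≡upper : ∀ w → 2 * excess w ≡ excess w * coverage w × c̄ w ≡ c̄ w * ballSum w excess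
    lower≡upper w = +-≤-≡⇒≡ (2*excess≤excess*coverage w) (c̄≤c̄*ballSum-excess w)
                             (sumW-mono-≡⇒≡ lower≤upper (trans sumW-lower (sym sumW-upper)) w)

  excess≤1 : ∀ w → excess w ≤ 1
  excess≤1 w = 2*m≡m*[1+m]⇒m≤1 (excess w)
    (trans (proj₁ (lower≡upper w)) (cong (excess w *_) (coverage≡suc-excess w)))

  ballSum-excess-noncodeword : ∀ w → C w ≡ false → ballSum w excess ≡ 1
  ballSum-excess-noncodeword w Cw =
    sym (trans (subst (λ b → ⟦ not b ⟧ ≡ ⟦ not b ⟧ * ballSum w excess) Cw (proj₂ (lower≡upper w))) (+-identityʳ _))

  ballSum-excess-codeword : ∀ w → C w ≡ true → ballSum w excess ≡ 2 * near w
  ballSum-excess-codeword w Cw = +-cancelʳ-≡ (suc n) _ _ (trans (ballSum-excess-parity₁ w Cw) (+-comm (suc n) _))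

  near-noncodeword : ∀ w → C w ≡ false → 2 * near w ≡ 2 + n
  near-noncodeword w Cw = trans (sym (ballSum-excess-parity₀ w Cw)) (cong (_+ suc n) (ballSum-excess-noncodeword w Cw))

  -- If a codeword had no other codeword within distance 2, each of its n neighbours y would have
  -- 2 * near y ≡ n + 2; summing over them gives n * n ≡ 6 * sumDist3 w c, impossible for n = 2 ^ r.
  near-pos : ∀ w → C w ≡ true → 1 ≤ near w
  near-pos w Cw with near w in near≡
  ... | suc _ = s≤s z≤n
  ... | zero  = contradiction (sym n*n≡6*Q₃) (6*≢2^r*2^r r (sumDist3 w c))
    where
    N≡0 : sumNbrs w c ≡ 0
    N≡0 = m+n≡0⇒m≡0 _ near≡

    Q₂≡0 : sumDist2 w c ≡ 0
    Q₂≡0 = m+n≡0⇒n≡0 _ near≡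

    nbr-noncodeword : ∀ j → C (flip j w) ≡ false
    nbr-noncodeword j with C (flip j w) | flip≤sumNbrs w c j
    ... | false | _    = refl
    ... | true  | 1≤N = contradiction (subst (1 ≤_) N≡0 1≤N) λ ()

    sumNbrs-Q₂ : sumNbrs w (λ y → sumDist2 y c) ≡ 3 * sumDist3 w c
    sumNbrs-Q₂ = begin
      sumNbrs w (λ y → sumDist2 y c)                   ≡⟨ +-identityʳ _ ⟨
      sumNbrs w (λ y → sumDist2 y c) + 0               ≡⟨ cong (sumNbrs w (λ y → sumDist2 y c) +_) N≡0 ⟨
      sumNbrs w (λ y → sumDist2 y c) + sumNbrs w c     ≡⟨ sumNbrs-sumDist2 w c ⟩
      n * sumNbrs w c + 3 * sumDist3 w c               ≡⟨ cong (λ k → n * k + 3 * sumDist3 w c) N≡0 ⟩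
      n * 0 + 3 * sumDist3 w c                         ≡⟨ cong (_+ 3 * sumDist3 w c) (*-zeroʳ n) ⟩
      3 * sumDist3 w c                                 ∎

    sumNbrs-N : sumNbrs w (λ y → sumNbrs y c) ≡ n
    sumNbrs-N = begin
      sumNbrs w (λ y → sumNbrs y c)    ≡⟨ sumNbrs² w c ⟩
      n * c w + 2 * sumDist2 w c       ≡⟨ cong₂ (λ b q → n * ⟦ b ⟧ + 2 * q) Cw Q₂≡0 ⟩
      n * 1 + 2 * 0                    ≡⟨ arith n ⟩
      n                                ∎
      where
      arith : ∀ n → n * 1 + 2 * 0 ≡ n
      arith = solve-∀

    n*n≡6*Q₃ : n * n ≡ 6 * sumDist3 w c
    n*n≡6*Q₃ = +-cancelʳ-≡ (2 * n) _ _ (begin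
      n * n + 2 * n                      ≡⟨ arith₁ n ⟩
      n * (2 + n)                        ≡⟨ sumNbrs-const w (2 + n) ⟨
      sumNbrs w (λ _ → 2 + n)            ≡⟨ sumNbrs-cong w (λ j → near-noncodeword (flip j w) (nbr-noncodeword j)) ⟨
      sumNbrs w (λ y → 2 * near y)       ≡⟨ sumNbrs-* w 2 near ⟩
      2 * sumNbrs w near                 ≡⟨ cong (2 *_) (sumNbrs-+ w (λ y → sumNbrs y c) (λ y → sumDist2 y c)) ⟩
      2 * (sumNbrs w (λ y → sumNbrs y c) + sumNbrs w (λ y → sumDist2 y c))
                                         ≡⟨ cong₂ (λ u v → 2 * (u + v)) sumNbrs-N sumNbrs-Q₂ ⟩
      2 * (n + 3 * sumDist3 w c)         ≡⟨ arith₂ n (sumDist3 w c) ⟩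
      6 * sumDist3 w c + 2 * n           ∎)
      where
      arith₁ : ∀ n → n * n + 2 * n ≡ n * (2 + n)
      arith₁ = solve-∀
      arith₂ : ∀ n q → 2 * (n + 3 * q) ≡ 6 * q + 2 * n
      arith₂ = solve-∀

  private
    sumW-c*near : sumW (λ w → c w * near w) ≡ sumW c
    sumW-c*near = *-cancelˡ-≡ _ _ 2 (begin
      2 * sumW (λ w → c w * near w)        ≡⟨ sumW-* 2 (λ w → c w * near w) ⟨
      sumW (λ w → 2 * (c w * near w))      ≡⟨ sumW-cong c*ballSum-excess ⟨
      sumW (λ w → c w * ballSum w excess)  ≡⟨ ballSum-symmetric c excess ⟩
      sumW (λ w → excess w * coverage w)   ≡⟨ sumW-cong (λ w → proj₁ (lower≡upper w)) ⟨
      sumW (λ w → 2 * excess w)            ≡⟨ sumW-* 2 excess ⟩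
      2 * sumW excess                      ≡⟨ cong (2 *_) (trans sumW-excess (sym sumW-c)) ⟩
      2 * sumW c                           ∎)
      where
      c*ballSum-excess : ∀ w → c w * ballSum w excess ≡ 2 * (c w * near w)
      c*ballSum-excess w = by-membership (C w) refl
        where
        by-membership : ∀ b → C w ≡ b → ⟦ b ⟧ * ballSum w excess ≡ 2 * (⟦ b ⟧ * near w)
        by-membership true  Cw = trans (*-identityˡ _) (trans (ballSum-excess-codeword w Cw)
                                                              (cong (2 *_) (sym (*-identityˡ (near w)))))
        by-membership false _  = refl

    c≤c*near : ∀ w → c w ≤ c w * near w
    c≤c*near w = by-membership (C w) refl
      where
      by-membership : ∀ b → C w ≡ b → ⟦ b ⟧ ≤ ⟦ b ⟧ * near w
      by-membership true  Cw = subst (1 ≤_) (sym (*-identityˡ _)) (near-pos w Cw)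
      by-membership false _  = z≤n

  near-codeword : ∀ w → C w ≡ true → near w ≡ 1
  near-codeword w Cw =
    sym (trans (subst (λ b → ⟦ b ⟧ ≡ ⟦ b ⟧ * near w) Cw (sumW-mono-≡⇒≡ c≤c*near (sym sumW-c*near) w))
               (*-identityˡ _))

  ballSum-excess : ∀ w → ballSum w excess ≡ suc (c w)
  ballSum-excess w = by-membership (C w) refl
    where
    by-membership : ∀ b → C w ≡ b → ballSum w excess ≡ suc ⟦ b ⟧
    by-membership true  Cw = trans (ballSum-excess-codeword w Cw) (cong (2 *_) (near-codeword w Cw))
    by-membership false Cw = ballSum-excess-noncodeword w Cw

  coveredTwice : Code n
  coveredTwice w = excess w ≡ᵇ 1

  ⟦coveredTwice⟧ : ∀ w → ⟦ coveredTwice w ⟧ ≡ excess w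
  ⟦coveredTwice⟧ w = ⟦≡ᵇ1⟧ (excess w) (excess≤1 w)
    where
    ⟦≡ᵇ1⟧ : ∀ k → k ≤ 1 → ⟦ k ≡ᵇ 1 ⟧ ≡ k
    ⟦≡ᵇ1⟧ zero       _ = refl
    ⟦≡ᵇ1⟧ (suc zero) _ = refl
    ⟦≡ᵇ1⟧ (suc (suc _)) (s≤s ())

  coverage⇒coveredTwice : ∀ w {b} → coverage w ≡ suc ⟦ b ⟧ → coveredTwice w ≡ b
  coverage⇒coveredTwice w {b} coverage≡ = trans (cong (λ k → (k ∸ 1) ≡ᵇ 1) coverage≡) (⟦⟧≡ᵇ1 b)
    where
    ⟦⟧≡ᵇ1 : ∀ b → (⟦ b ⟧ ≡ᵇ 1) ≡ b
    ⟦⟧≡ᵇ1 true  = refl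
    ⟦⟧≡ᵇ1 false = refl

  ballSum-C : ∀ x → ballSum x c ≡ suc ⟦ coveredTwice x ⟧
  ballSum-C x = trans (coverage≡suc-excess x) (cong suc (sym (⟦coveredTwice⟧ x)))

  ballSum-coveredTwice : ∀ x → ballSum x (λ v → ⟦ coveredTwice v ⟧) ≡ suc (c x)
  ballSum-coveredTwice x =
    trans (cong₂ _+_ (⟦coveredTwice⟧ x) (sumNbrs-cong x (λ j → ⟦coveredTwice⟧ (flip j x)))) (ballSum-excess x)

  diamondExtension : Bool → Code (suc n)
  diamondExtension b = glue b C coveredTwice

  diamondExtension-locallyDiamond : ∀ b → LocallyDiamond (diamondExtension b)
  diamondExtension-locallyDiamond b = glue-locallyDiamond b ballSum-C ballSum-coveredTwice

  diamondExtension-zeros : ∀ b →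
    diamondExtension b (zeros (suc n)) ≡ (if b then coveredTwice (zeros n) else C (zeros n))
  diamondExtension-zeros b = glue-zeros b C coveredTwice

-- Syndrome codes and the classification of ENP1CCs

infixl 6 _⊕_
_⊕_ : ∀ {r} → Word r → Word r → Word r
_⊕_ = zipWith _xor_

⊕-assoc : ∀ {r} (u v w : Word r) → (u ⊕ v) ⊕ w ≡ u ⊕ (v ⊕ w)
⊕-assoc = zipWith-assoc xor-assoc

⊕-comm : ∀ {r} (u v : Word r) → u ⊕ v ≡ v ⊕ u
⊕-comm = zipWith-comm xor-comm

⊕-identityʳ : ∀ {r} (u : Word r) → u ⊕ zeros r ≡ u
⊕-identityʳ = zipWith-identityʳ xor-identityʳ

⊕-identityˡ : ∀ {r} (u : Word r) → zeros r ⊕ u ≡ u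
⊕-identityˡ = zipWith-identityˡ (λ _ → refl)

⊕-self : ∀ {r} (u : Word r) → u ⊕ u ≡ zeros r
⊕-self u = trans (cong (u ⊕_) (sym (map-id u))) (zipWith-inverseʳ {⁻¹ = id} xor-same u)

==-⊕ : ∀ {r} (a y s : Word r) → (a ⊕ y) == s ≡ y == (a ⊕ s)
==-⊕ a y s = cong (λ v → weight v ≡ᵇ 0) (trans (cong (_⊕ s) (⊕-comm a y)) (⊕-assoc y a s))

syndrome : ∀ {m r} → (Fin m → Word r) → Word m → Word r
syndrome {r = r} H []      = zeros r
syndrome {r = r} H (a ∷ x) = (if a then H zero else zeros r) ⊕ syndrome (H ∘ suc) x

syndrome-zeros : ∀ {m r} (H : Fin m → Word r) → syndrome H (zeros m) ≡ zeros r
syndrome-zeros {zero}  H = refl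
syndrome-zeros {suc m} H = trans (⊕-identityˡ _) (syndrome-zeros (H ∘ suc))

syndrome-flip : ∀ {m r} (H : Fin m → Word r) j x → syndrome H (flip j x) ≡ H j ⊕ syndrome H x
syndrome-flip H zero (false ∷ x) = cong (H zero ⊕_) (sym (⊕-identityˡ _))
syndrome-flip {r = r} H zero (true ∷ x)  = begin
  zeros r ⊕ syndrome (H ∘ suc) x                 ≡⟨ ⊕-identityˡ _ ⟩
  syndrome (H ∘ suc) x                           ≡⟨ ⊕-identityˡ _ ⟨
  zeros r ⊕ syndrome (H ∘ suc) x                 ≡⟨ cong (_⊕ syndrome (H ∘ suc) x) (⊕-self (H zero)) ⟨
  H zero ⊕ H zero ⊕ syndrome (H ∘ suc) x         ≡⟨ ⊕-assoc (H zero) _ _ ⟩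
  H zero ⊕ (H zero ⊕ syndrome (H ∘ suc) x)       ∎
syndrome-flip {r = r} H (suc j) (a ∷ x) = begin
  h ⊕ syndrome (H ∘ suc) (flip j x)       ≡⟨ cong (h ⊕_) (syndrome-flip (H ∘ suc) j x) ⟩
  h ⊕ (H (suc j) ⊕ syndrome (H ∘ suc) x)  ≡⟨ ⊕-assoc h _ _ ⟨
  h ⊕ H (suc j) ⊕ syndrome (H ∘ suc) x    ≡⟨ cong (_⊕ syndrome (H ∘ suc) x) (⊕-comm h (H (suc j))) ⟩
  H (suc j) ⊕ h ⊕ syndrome (H ∘ suc) x    ≡⟨ ⊕-assoc (H (suc j)) h _ ⟩
  H (suc j) ⊕ (h ⊕ syndrome (H ∘ suc) x)  ∎
  where
  h : Word r
  h = if a then H zero else zeros r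

syndromeCode : ∀ {m r} → (Fin m → Word r) → Word r → Code m
syndromeCode H s x = syndrome H x == s

module SurjectiveSyndrome {m r} (H : Fin m → Word r) (H-surjective : ∀ t → ∃[ j ] H j ≡ t) where

  fibre : Word r → ℕ
  fibre t = sumW (λ x → ⟦ syndromeCode H t x ⟧)

  fibre-translate : ∀ t j → fibre t ≡ fibre (H j ⊕ t)
  fibre-translate t j = begin
    fibre t
      ≡⟨ sumW-flip j (λ x → ⟦ syndromeCode H t x ⟧) ⟨
    sumW (λ x → ⟦ syndrome H (flip j x) == t ⟧)
      ≡⟨ sumW-cong (λ x → cong (λ y → ⟦ y == t ⟧) (syndrome-flip H j x)) ⟩
    sumW (λ x → ⟦ (H j ⊕ syndrome H x) == t ⟧)
      ≡⟨ sumW-cong (λ x → cong ⟦_⟧ (==-⊕ (H j) (syndrome H x) t)) ⟩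
    fibre (H j ⊕ t) ∎

  fibre-const : ∀ t → fibre t ≡ fibre (zeros r)
  fibre-const t with H-surjective t
  ... | j , Hj≡t = sym (trans (fibre-translate (zeros r) j) (cong fibre (trans (⊕-identityʳ (H j)) Hj≡t)))

  2^r*fibre : ∀ t → 2 ^ r * fibre t ≡ 2 ^ m
  2^r*fibre t = begin
    2 ^ r * fibre t                                ≡⟨ sumW-const {r} (fibre t) ⟨
    sumW {r} (λ _ → fibre t)                       ≡⟨ sumW-cong (λ t′ → trans (fibre-const t) (sym (fibre-const t′))) ⟩
    sumW fibre                                     ≡⟨ sumW-swap (λ t x → ⟦ syndromeCode H t x ⟧) ⟩
    sumW (λ x → sumW (λ t → ⟦ syndrome H x == t ⟧)) ≡⟨ sumW-cong (λ x → sumW-== (syndrome H x)) ⟩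
    sumW {m} (λ _ → 1)                             ≡⟨ trans (sumW-const {m} 1) (*-identityʳ _) ⟩
    2 ^ m                                          ∎

  covering : ∀ s w → ∃[ c ] (syndromeCode H s c ≡ true × dist w c ≤ 1)
  covering s w with H-surjective (s ⊕ syndrome H w)
  ... | j , Hj≡s⊕syn = flip j w , code , ≤-reflexive (dist-flip j w)
    where
    code : syndrome H (flip j w) == s ≡ true
    code = begin
      syndrome H (flip j w) == s             ≡⟨ cong (_== s) (syndrome-flip H j w) ⟩
      (H j ⊕ syndrome H w) == s              ≡⟨ cong (λ h → (h ⊕ syndrome H w) == s) Hj≡s⊕syn ⟩
      (s ⊕ syndrome H w ⊕ syndrome H w) == s ≡⟨ cong (_== s) (⊕-assoc s _ _) ⟩
      (s ⊕ (syndrome H w ⊕ syndrome H w)) == s ≡⟨ cong (λ v → (s ⊕ v) == s) (⊕-self _) ⟩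
      (s ⊕ zeros r) == s                     ≡⟨ cong (_== s) (⊕-identityʳ s) ⟩
      s == s                                 ≡⟨ ==-refl s ⟩
      true                                   ∎

  -- Summed over all s the left side is 1 + m; it is at least 1 by covering, and at least 2 for
  -- s = 0 through the zero column, so for m = 2 ^ r these bounds are attained.
  ballSum-zeros : m ≡ 2 ^ r → ∀ s →
    ballSum (zeros m) (λ x → ⟦ syndromeCode H s x ⟧) ≡ suc ⟦ zeros r == s ⟧
  ballSum-zeros m≡2^r = λ s → sym (sumW-mono-≡⇒≡ lower≤ball (trans sumW-lower (sym sumW-ball)) s)
    where
    ball lower : Word r → ℕ
    ball s  = ballSum (zeros m) (λ x → ⟦ syndromeCode H s x ⟧)
    lower s = suc ⟦ zeros r == s ⟧

    lower≤ball : ∀ s → lower s ≤ ball s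
    lower≤ball s with zeros r == s in 0==s
    ... | false = covering⇒ballSum-pos (covering s) (zeros m)
    ... | true  with H-surjective (zeros r)
    ...   | j₀ , Hj₀≡0 = +-mono-≤ (≤-reflexive (cong ⟦_⟧ (sym (in-code (zeros m) (syndrome-zeros H)))))
                                  (≤-trans (≤-reflexive (cong ⟦_⟧ (sym (in-code (flip j₀ (zeros m)) syndrome-flip₀))))
                                           (flip≤sumNbrs (zeros m) _ j₀))
      where
      in-code : ∀ x → syndrome H x ≡ zeros r → syndromeCode H s x ≡ true
      in-code x syn≡0 = trans (cong (_== s) syn≡0) 0==s
      syndrome-flip₀ : syndrome H (flip j₀ (zeros m)) ≡ zeros r
      syndrome-flip₀ = trans (syndrome-flip H j₀ (zeros m))
                             (trans (cong₂ _⊕_ Hj₀≡0 (syndrome-zeros H)) (⊕-self (zeros r)))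

    sumW-lower : sumW lower ≡ suc (2 ^ r)
    sumW-lower = begin
      sumW {r} (λ s → 1 + ⟦ zeros r == s ⟧)
        ≡⟨ sumW-+ {r} (λ _ → 1) _ ⟩
      sumW {r} (λ _ → 1) + sumW (λ s → ⟦ zeros r == s ⟧)
        ≡⟨ cong₂ _+_ (trans (sumW-const {r} 1) (*-identityʳ _)) (sumW-== (zeros r)) ⟩
      2 ^ r + 1
        ≡⟨ +-comm (2 ^ r) 1 ⟩
      suc (2 ^ r) ∎

    sumW-ball : sumW ball ≡ suc (2 ^ r)
    sumW-ball = begin
      sumW ball
        ≡⟨ sumW-+ (λ s → ⟦ syndrome H (zeros m) == s ⟧) _ ⟩
      sumW (λ s → ⟦ syndrome H (zeros m) == s ⟧) + sumW (λ s → sumNbrs (zeros m) (λ x → ⟦ syndrome H x == s ⟧))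
        ≡⟨ cong₂ _+_ (sumW-== (syndrome H (zeros m)))
                     (sym (sumNbrs-sumW (zeros m) (λ x s → ⟦ syndrome H x == s ⟧))) ⟩
      1 + sumNbrs (zeros m) (λ x → sumW (λ s → ⟦ syndrome H x == s ⟧))
        ≡⟨ cong suc (sumNbrs-cong (zeros m) (λ j → sumW-== (syndrome H (flip j (zeros m))))) ⟩
      1 + sumNbrs (zeros m) (λ _ → 1)
        ≡⟨ cong suc (trans (sumNbrs-const (zeros m) 1) (trans (*-identityʳ m) m≡2^r)) ⟩
      suc (2 ^ r) ∎

column : ∀ {r} → Fin (2 ^ r) → Word r
column j = tabulate (λ k → Inverse.to 2↔Bool (finToFun j k))

column-surjective : ∀ {r} (t : Word r) → ∃[ j ] column j ≡ t
column-surjective t = funToFin (λ k → Inverse.from 2↔Bool (lookup t k)) , (begin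
  tabulate (λ k → Inverse.to 2↔Bool (finToFun (funToFin (λ k → Inverse.from 2↔Bool (lookup t k))) k))
    ≡⟨ tabulate-cong (λ k → cong (Inverse.to 2↔Bool) (finToFun-funToFin _ k)) ⟩
  tabulate (λ k → Inverse.to 2↔Bool (Inverse.from 2↔Bool (lookup t k)))
    ≡⟨ tabulate-cong (λ k → Inverse.strictlyInverseˡ 2↔Bool (lookup t k)) ⟩
  tabulate (lookup t)
    ≡⟨ tabulate∘lookup t ⟩
  t ∎)

-- With all 2 ^ r columns, including the zero column, this is the Hamming code of length
-- 2 ^ r - 1 with one free coordinate added (s = 0), or a coset of it.
hammingCoset : ∀ r → Word r → Code (2 ^ r)
hammingCoset r = syndromeCode column

module _ {r} (s : Word r) where
  open SurjectiveSyndrome (column {r}) column-surjective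

  hammingCoset-NP1CC : NP1CC r (hammingCoset r s)
  hammingCoset-NP1CC = size≡ , covering s
    where
    size≡ : size (hammingCoset r s) ≡ 2 ^ (2 ^ r ∸ r)
    size≡ = *-cancelˡ-≡ _ _ (2 ^ r) {{m^n≢0 2 r}}
      (trans (cong (2 ^ r *_) (countW≡sumW (hammingCoset r s))) (trans (2^r*fibre s) (sym (2^r*2^[2^r∸r] r))))

  hammingCoset-zeros : hammingCoset r s (zeros (2 ^ r)) ≡ zeros r == s
  hammingCoset-zeros = cong (_== s) (syndrome-zeros column)

  hammingCoset-ballSum-zeros : ballSum (zeros (2 ^ r)) (λ x → ⟦ hammingCoset r s x ⟧) ≡ suc ⟦ zeros r == s ⟧
  hammingCoset-ballSum-zeros = ballSum-zeros refl s

e₁ : ∀ {r} → 1 ≤ r → Word r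
e₁ {suc r} _ = true ∷ zeros r

zeros==e₁ : ∀ {r} (r≥1 : 1 ≤ r) → zeros r == e₁ r≥1 ≡ false
zeros==e₁ {suc r} _ = refl

module ENP1CCClassification {r} (r≥1 : 1 ≤ r) where

  private
    n : ℕ
    n = 2 ^ r

  open NP1CCStructure r≥1
    using (coveredTwice; coverage⇒coveredTwice; diamondExtension; diamondExtension-locallyDiamond; diamondExtension-zeros)

  ext-sameWD : ∀ {C C'} (np : NP1CC r C) (np' : NP1CC r C') b →
    diamondExtension np b (zeros (suc n)) ≡ diamondExtension np' b (zeros (suc n)) → SameWD (ext b C) (ext b C')
  ext-sameWD {C} {C'} np np' b D₀≡D₀′ i = begin
    A (ext b C) i                    ≡⟨ A-ext b C (coveredTwice np) i ⟩
    κ * A (diamondExtension np b) i  ≡⟨ cong (κ *_) (locallyDiamond-sameWD (diamondExtension-locallyDiamond np b)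
                                                       (diamondExtension-locallyDiamond np' b) D₀≡D₀′ i) ⟩
    κ * A (diamondExtension np' b) i ≡⟨ A-ext b C' (coveredTwice np') i ⟨
    A (ext b C') i                   ∎
    where
    κ : ℕ
    κ = ⟦ not (isOdd i xor b) ⟧

  modelSyndrome : Bool → Word r
  modelSyndrome d = if d then zeros r else e₁ r≥1

  model : Bool → Bool → Code (suc n)
  model b d = ext b (hammingCoset r (modelSyndrome d))

  private
    model-np : ∀ d → NP1CC r (hammingCoset r (modelSyndrome d))
    model-np d = hammingCoset-NP1CC (modelSyndrome d)

    zeros==modelSyndrome : ∀ d → zeros r == modelSyndrome d ≡ d
    zeros==modelSyndrome true  = ==-refl (zeros r)
    zeros==modelSyndrome false = zeros==e₁ r≥1

  modelDiamond-zeros : ∀ b d → diamondExtension (model-np d) b (zeros (suc n)) ≡ d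
  modelDiamond-zeros b d = trans (diamondExtension-zeros (model-np d) b) (at-zero b)
    where
    s : Word r
    s = modelSyndrome d
    at-zero : ∀ b → (if b then coveredTwice (model-np d) (zeros n) else hammingCoset r s (zeros n)) ≡ d
    at-zero true  = trans (coverage⇒coveredTwice (model-np d) (zeros n) (hammingCoset-ballSum-zeros s))
                          (zeros==modelSyndrome d)
    at-zero false = trans (hammingCoset-zeros s) (zeros==modelSyndrome d)

  ENP1CC-sameWD-model : ∀ {E C b} (np : NP1CC r C) → (∀ w → E w ≡ ext b C w) →
    ∀ {d} → diamondExtension np b (zeros (suc n)) ≡ d → SameWD E (model b d)
  ENP1CC-sameWD-model {b = b} np E≡ext {d} D₀≡d i =
    trans (A-cong E≡ext i) (ext-sameWD np (model-np d) b (trans D₀≡d (sym (modelDiamond-zeros b d))) i)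

  private
    ENP1CC-zeros : ∀ {E : Code (suc n)} {C b} → (∀ w → E w ≡ ext b C w) →
      E (zeros (suc n)) ≡ not b ∧ C (zeros n)
    ENP1CC-zeros {C = C} {b} E≡ext = trans (E≡ext (zeros (suc n))) (ext-zeros b C)


  zeroed-sameWD : ∀ {E} → ENP1CC r E → Zeroed E → SameWD E (model false true)
  zeroed-sameWD (C , true  , np , E≡ext) E₀ = contradiction (trans (sym E₀) (ENP1CC-zeros {C = C} E≡ext)) λ ()
  zeroed-sameWD (C , false , np , E≡ext) E₀ =
    ENP1CC-sameWD-model np E≡ext
      (trans (diamondExtension-zeros np false) (trans (sym (ENP1CC-zeros {C = C} E≡ext)) E₀))

  nonzeroed-classification : ∀ {E} → ENP1CC r E → ¬ Zeroed E →
    SameWD E (model true false) ⊎ SameWD E (model true true) ⊎ SameWD E (model false false)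
  nonzeroed-classification (C , false , np , E≡ext) ¬E₀ = inj₂ (inj₂ (ENP1CC-sameWD-model np E≡ext
    (trans (diamondExtension-zeros np false) (trans (sym (ENP1CC-zeros {C = C} E≡ext)) (¬-not ¬E₀)))))
  nonzeroed-classification (C , true  , np , E≡ext) _ with diamondExtension np true (zeros (suc n)) in D₀
  ... | false = inj₁ (ENP1CC-sameWD-model np E≡ext D₀)
  ... | true  = inj₂ (inj₁ (ENP1CC-sameWD-model np E≡ext D₀))

  model-ENP1CC : ∀ b d → ENP1CC r (model b d)
  model-ENP1CC b d = hammingCoset r (modelSyndrome d) , b , model-np d , λ _ → refl

  model-zeros : ∀ b d → model b d (zeros (suc n)) ≡ not b ∧ d
  model-zeros b d = trans (ext-zeros b (hammingCoset r (modelSyndrome d)))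
    (cong (not b ∧_) (trans (hammingCoset-zeros (modelSyndrome d)) (zeros==modelSyndrome d)))

  private
    model-A : ∀ b d i → A (model b d) i ≡ ⟦ not (isOdd i xor b) ⟧ * A (diamondExtension (model-np d) b) i
    model-A b d = A-ext b (hammingCoset r (modelSyndrome d)) (coveredTwice (model-np d))

  model-witness : ∀ b d → not b ∧ d ≡ false → ∃[ E ] (ENP1CC r E × ¬ Zeroed E × SameWD E (model b d))
  model-witness b d ¬b∧d≡false =
      model b d , model-ENP1CC b d
    , (λ E₀ → contradiction (trans (sym E₀) (trans (model-zeros b d) ¬b∧d≡false)) λ ())
    , λ _ → refl

  model-A-parity : ∀ b d i → isOdd i ≡ not b → A (model b d) i ≡ 0
  model-A-parity b d i odd≡ = begin
    A (model b d) i                 ≡⟨ model-A b d i ⟩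
    ⟦ not (isOdd i xor b) ⟧ * A D i ≡⟨ cong (λ p → ⟦ not (p xor b) ⟧ * A D i) odd≡ ⟩
    ⟦ not (not b xor b) ⟧ * A D i   ≡⟨ cong (_* A D i) (not-b-xor-b b) ⟩
    0                               ∎
    where
    D : Code (suc n)
    D = diamondExtension (model-np d) b
    not-b-xor-b : ∀ b → ⟦ not (not b xor b) ⟧ ≡ 0
    not-b-xor-b true  = refl
    not-b-xor-b false = refl

  model-A₀ : ∀ b d → A (model b d) 0 ≡ ⟦ not b ∧ d ⟧
  model-A₀ b d = trans (A-zero (model b d)) (cong ⟦_⟧ (model-zeros b d))

  model-A₁ : ∀ b d → A (model b d) 1 ≡ ⟦ b ⟧ * suc ⟦ d ⟧
  model-A₁ b d = begin
    A (model b d) 1                        ≡⟨ model-A b d 1 ⟩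
    ⟦ not (not b) ⟧ * A D 1                ≡⟨ cong₂ (λ b′ a → ⟦ b′ ⟧ * a) (not-involutive b)
                                                    (locallyDiamond-A₁ (diamondExtension-locallyDiamond (model-np d) b)) ⟩
    ⟦ b ⟧ * suc ⟦ D (zeros (suc n)) ⟧      ≡⟨ cong (λ d′ → ⟦ b ⟧ * suc ⟦ d′ ⟧) (modelDiamond-zeros b d) ⟩
    ⟦ b ⟧ * suc ⟦ d ⟧                      ∎
    where
    D : Code (suc n)
    D = diamondExtension (model-np d) b

  model-A₂ : A (model false false) 2 ≡ 2 ^ r / 2 + 1
  model-A₂ = begin
    A (model false false) 2 ≡⟨ model-A false false 2 ⟩
    1 * A D 2               ≡⟨ *-identityˡ (A D 2) ⟩
    A D 2                   ≡⟨ 2*a≡2+2^r⇒a≡2^r/2+1 r≥1 (A D 2)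
                                 (locallyDiamond-A₂ (diamondExtension-locallyDiamond (model-np false) false)
                                                    (modelDiamond-zeros false false)) ⟩
    2 ^ r / 2 + 1           ∎
    where
    D : Code (suc n)
    D = diamondExtension (model-np false) false


theorem2 : (r : ℕ) → 2 ≤ r →
    ((C D : Code (suc (2 ^ r))) → Diamond C → Diamond D → Zeroed C → Zeroed D → SameWD C D) ×
    ((C D : Code (suc (2 ^ r))) → Diamond C → Diamond D → ¬ Zeroed C → ¬ Zeroed D → SameWD C D) ×
    ((C D : Code (suc (2 ^ r))) → ENP1CC r C → ENP1CC r D → Zeroed C → Zeroed D → SameWD C D) ×
    (Σ (ℕ → ℕ) λ W₁ → Σ (ℕ → ℕ) λ W₂ → Σ (ℕ → ℕ) λ W₃ →
      (W₁ 0 ≡ 0 × W₁ 1 ≡ 1 × W₁ 2 ≡ 0) ×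
      (W₂ 0 ≡ 0 × W₂ 1 ≡ 2 × W₂ 2 ≡ 0) ×
      (W₃ 0 ≡ 0 × W₃ 1 ≡ 0 × W₃ 2 ≡ 2 ^ r / 2 + 1) ×
      ((C : Code (suc (2 ^ r))) → ENP1CC r C → ¬ Zeroed C →
        (∀ i → A C i ≡ W₁ i) ⊎ (∀ i → A C i ≡ W₂ i) ⊎ (∀ i → A C i ≡ W₃ i)) ×
      (∃[ C ] (ENP1CC r C × ¬ Zeroed C × (∀ i → A C i ≡ W₁ i))) ×
      (∃[ C ] (ENP1CC r C × ¬ Zeroed C × (∀ i → A C i ≡ W₂ i))) ×
      (∃[ C ] (ENP1CC r C × ¬ Zeroed C × (∀ i → A C i ≡ W₃ i))))
theorem2 r r≥2 =
    (λ C D dC dD C₀ D₀ → diamond-sameWD dC dD (trans C₀ (sym D₀)))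
  , (λ C D dC dD ¬C₀ ¬D₀ → diamond-sameWD dC dD (trans (¬-not ¬C₀) (sym (¬-not ¬D₀))))
  , (λ C D eC eD C₀ D₀ i → trans (zeroed-sameWD eC C₀ i) (sym (zeroed-sameWD eD D₀ i)))
  , A (model true false) , A (model true true) , A (model false false)
  , (model-A-parity true false 0 refl , model-A₁ true false , model-A-parity true false 2 refl)
  , (model-A-parity true true 0 refl , model-A₁ true true , model-A-parity true true 2 refl)
  , (model-A₀ false false , model-A-parity false false 1 refl , model-A₂)
  , (λ C → nonzeroed-classification)
  , model-witness true false refl , model-witness true true refl , model-witness false false refl
  where open ENP1CCClassification (≤-trans (s≤s z≤n) r≥2)
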